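{- Let $q$ be an odd prime power, $\delta\in\mathbb{F}_{q^2}$ and $\gamma\in\mathbb{F}_q^*$. Then the polynomial $$f(x)=(x^q-x+\delta)^{q+2}+\gamma(x^q+x)$$ is a permutation polynomial of $\mathbb{F}_{q^2}$ if and only if either $q\equiv0\pmod 3$, or $q\equiv2\pmod 3$ and $\mathrm{Tr}_q^{q^2}(\delta)=0$.
   Context: A polynomial over a finite field $\mathbb{F}$ is a permutation polynomial of $\mathbb{F}$ if the map it induces on $\mathbb{F}$ is a bijection. For $x\in\mathbb{F}_{q^2}$, $\mathrm{Tr}_q^{q^2}(x)=x+x^q$. -}

module Defs where

open import Level using (Level; _⊔_)
open import Data.Nat using (ℕ; suc) renaming (_^_ to _^ℕ_)
import Data.Nat
open import Data.Nat.Primality using (Prime)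
open import Data.Fin using (Fin)
open import Data.Product using (Σ; ∃; _×_; _,_)
open import Relation.Nullary using (¬_)
open import Relation.Binary.PropositionalEquality using (_≡_)
import Relation.Binary.PropositionalEquality as ≡
open import Algebra.Bundles using (CommutativeRing)
import Algebra.Bundles
import Algebra.Definitions.RawSemiring as RS
open import Function.Bundles using (Bijection)
open import Function.Definitions using (Bijective)

record Field (c ℓ : Level) : Set (Level.suc (c ⊔ ℓ)) where
  field
    commRing : CommutativeRing c ℓ
  open CommutativeRing commRing public
  field
    0≉1     : ¬ (0# ≈ 1#)
    inverse : ∀ x → ¬ (x ≈ 0#) → ∃ λ y → (x * y) ≈ 1#

  open RS (Algebra.Bundles.Semiring.rawSemiring semiring) public using (_^_)


HasCard : ∀ {c ℓ} → Field c ℓ → ℕ → Set (c ⊔ ℓ)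
HasCard F n = Bijection (CommutativeRing.setoid (Field.commRing F)) (≡.setoid (Fin n))

IsOddPrimePower : ℕ → Set
IsOddPrimePower q = Σ ℕ λ p → Σ ℕ λ k →
  Prime p × ¬ (p ≡ 2) × q ≡ p ^ℕ (suc k)

IsPermutation : ∀ {c ℓ} (F : Field c ℓ) → (Field.Carrier F → Field.Carrier F) → Set (c ⊔ ℓ)
IsPermutation F f = Bijective _≈_ _≈_ f
  where open Field F

module _ {c ℓ} (F : Field c ℓ) (q : ℕ) where
  open Field F

  Tr : Carrier → Carrier
  Tr x = x + (x ^ q)

  InFq : Carrier → Set ℓ
  InFq x = (x ^ q) ≈ x

  fpoly : Carrier → Carrier → Carrier → Carrier
  fpoly δ γ x = ((((x ^ q) - x) + δ) ^ (q Data.Nat.+ 2)) + (γ * ((x ^ q) + x))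

-- Let φ x = x ^ q, U x = φ x - x and M = Tr δ ∈ F_q. As φ is additive, U is invariant under
-- translation by t ∈ F_q, while f (x + t) = f x + 2γt; and a direct computation gives
-- 4 (φ (f x) - f x) = W³ - M² W for W = 2 U x - U δ, which ranges over the trace-zero elements.
-- Hence f is injective (equivalently, a permutation) iff w ↦ w³ - M² w is injective on the
-- trace-zero elements.
-- A collision A ≠ B of that cubic means A² + AB + B² = M². In characteristic 3 it would give
-- (A - B)² = M², so A - B = ±M ∈ F_q, impossible for a nonzero trace-zero element; for
-- q ≡ 2 (mod 3) and M = 0 it would make A / B ∈ F_q a cube root of unity other than 1, but those
-- are moved by φ. Otherwise collisions come from the factorisation A² + AB + B² = (A - ζB)(A - ζ²B),
-- ζ a primitive cube root of unity: for q ≡ 1 (mod 3) the factors can be Z and M² / Z for a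
-- trace-zero Z, and for q ≡ 2 (mod 3) they are Z and -φ Z for Z of norm Z φ(Z) = -M²; if M ≠ 0,
-- Z and ζZ both have that norm and cannot both give A = B.
module Submission where

open import Defs
open import Algebra.Bundles using (Monoid; CommutativeMonoid; CommutativeRing)
open import Data.Fin.Base as Fin using (Fin; zero; suc)
import Data.Fin.Properties as Fin
open import Data.Nat.Base as ℕ using (ℕ; zero; suc; _∸_; _!)
import Data.Nat.Properties as ℕ
open import Data.Nat.Combinatorics using (_C_; k![n∸k]!∣n!)
open import Data.Nat.Combinatorics.Specification using (nCk≡n!/k![n-k]!)
open import Data.Nat.Divisibility using (_∣_; _∤_; divides; ∣1⇒≡1; ∣⇒≤; m∣m*n)
open import Data.Nat.DivMod using (m/n*n≡m)
open import Data.Nat.Primality using (Prime; ¬prime[1]; euclidsLemma)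
open import Data.Product.Base using (∃; _,_; proj₁; proj₂)
open import Data.Sum.Base using (inj₁; inj₂)
open import Function.Base using (_∘_)
open import Function.Definitions using (Injective; Surjective; Congruent)
open import Relation.Binary.PropositionalEquality.Core as ≡ using (_≡_; _≢_)
open import Relation.Nullary.Decidable using (yes; no)
open import Relation.Nullary.Negation using (¬_; contradiction)

p∤m! : ∀ {p m} → Prime p → m ℕ.< p → p ∤ m !
p∤m! {m = zero}  p-prime _   p∣1 = ¬prime[1] (≡.subst Prime (∣1⇒≡1 p∣1) p-prime)
p∤m! {m = suc m} p-prime m<p p∣m! with euclidsLemma (suc m) (m !) p-prime p∣m!
... | inj₁ p∣1+m = ℕ.<⇒≱ m<p (∣⇒≤ p∣1+m)
... | inj₂ p∣m!′ = p∤m! p-prime (ℕ.<-trans (ℕ.n<1+n m) m<p) p∣m!′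

nCk*k!*[n∸k]!≡n! : ∀ {n k} → k ℕ.≤ n → (n C k) ℕ.* (k ! ℕ.* (n ∸ k) !) ≡ n !
nCk*k!*[n∸k]!≡n! {n} {k} k≤n =
  ≡.trans (≡.cong (ℕ._* (k ! ℕ.* (n ∸ k) !)) (nCk≡n!/k![n-k]! k≤n)) (m/n*n≡m (k![n∸k]!∣n! k≤n))
  where instance _ = k ℕ.!* (n ∸ k) !≢0

p∣pCk : ∀ {p k} → Prime p → 0 ℕ.< k → k ℕ.< p → p ∣ p C k
p∣pCk {suc p} {k} p-prime 0<k k<p
  with euclidsLemma (suc p C k) (k ! ℕ.* (suc p ∸ k) !) p-prime
         (≡.subst (suc p ∣_) (≡.sym (nCk*k!*[n∸k]!≡n! (ℕ.<⇒≤ k<p))) (m∣m*n (p !)))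
... | inj₁ p∣pCk = p∣pCk
... | inj₂ p∣k!*[p∸k]! with euclidsLemma (k !) ((suc p ∸ k) !) p-prime p∣k!*[p∸k]!
...   | inj₁ p∣k!     = contradiction p∣k! (p∤m! p-prime k<p)
...   | inj₂ p∣[p∸k]! = contradiction p∣[p∸k]! (p∤m! p-prime (ℕ.∸-monoʳ-< {suc p} {k} {0} 0<k (ℕ.<⇒≤ k<p)))

p∣m^[1+n]⇒p∣m : ∀ {p} m n → Prime p → p ∣ m ℕ.^ suc n → p ∣ m
p∣m^[1+n]⇒p∣m m zero    p-prime p∣m^1 = ≡.subst (_ ∣_) (ℕ.*-identityʳ m) p∣m^1
p∣m^[1+n]⇒p∣m m (suc n) p-prime p∣m^[2+n] with euclidsLemma m (m ℕ.^ suc n) p-prime p∣m^[2+n]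
... | inj₁ p∣m       = p∣m
... | inj₂ p∣m^[1+n] = p∣m^[1+n]⇒p∣m m n p-prime p∣m^[1+n]

fin-injective⇒surjective : ∀ {n} {g : Fin n → Fin n} → Injective _≡_ _≡_ g → ∀ j → ∃ λ i → g i ≡ j
fin-injective⇒surjective {suc n} {g} g-injective j with Fin.any? (λ i → g i Fin.≟ j)
... | yes hit = hit
... | no miss = contradiction (Fin.injective⇒≤ punched-injective) ℕ.1+n≰n
  where
  punched : Fin (suc n) → Fin n
  punched i = Fin.punchOut {i = j} {j = g i} (λ j≡gi → miss (i , ≡.sym j≡gi))
  punched-injective : Injective _≡_ _≡_ punched
  punched-injective eq = g-injective (Fin.punchOut-injective {i = j} _ _ eq)

module _ {a ℓ} (M : Monoid a ℓ) where
  open Monoid M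
  open import Algebra.Properties.Monoid.Sum M using (sum; sum-cong-≋; sum-replicate-zero)

  sum-single : ∀ {n} (f : Fin n → Carrier) j → (∀ i → i ≢ j → f i ≈ ε) → sum f ≈ f j
  sum-single {suc n} f zero    rest =
    trans (∙-congˡ (trans (sum-cong-≋ (λ i → rest (suc i) λ ())) (sum-replicate-zero n))) (identityʳ _)
  sum-single {suc n} f (suc j) rest =
    trans (∙-congʳ (rest zero λ ()))
          (trans (identityˡ _) (sum-single (f ∘ suc) j (λ i i≢j → rest (suc i) (i≢j ∘ Fin.suc-injective))))

-- solve … refl compares normal forms by computation, so their coefficients need canonical forms:
-- they are taken in ℤ and mapped into R by fromℤ.
module IntegerCoefficients {c ℓ} (R : CommutativeRing c ℓ) where
  open import Data.Integer.Base as ℤ using (ℤ; +_; -[1+_])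
  import Data.Integer.Properties as ℤ
  open import Data.Sign.Base as Sign using (Sign)
  open import Data.Maybe.Base using (Maybe; just; nothing)
  open import Algebra.Solver.Ring.AlmostCommutativeRing
    using (_-Raw-AlmostCommutative⟶_; fromCommutativeRing)
  open CommutativeRing R hiding (zero)
  open import Algebra.Properties.Semiring.Mult.TCOptimised semiring
    using (_×_; ×-homo-+; ×1-homo-*)
  open import Algebra.Properties.Semiring.Exp semiring using (_^_)
  open import Algebra.Properties.Ring ring using (-‿distribˡ-*; -‿distribʳ-*; -‿involutive)
  open import Algebra.Properties.AbelianGroup +-abelianGroup using (⁻¹-∙-comm; ε⁻¹≈ε)
  open import Algebra.Properties.CommutativeSemigroup +-commutativeSemigroup using (interchange)
  open import Relation.Binary.Reasoning.Setoid setoid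

  fromℕ : ℕ → Carrier
  fromℕ n = n × 1#

  fromℕ-suc : ∀ n → fromℕ (suc n) ≈ 1# + fromℕ n
  fromℕ-suc = ×-homo-+ 1# 1

  fromℕ-+ : ∀ m n → fromℕ (m ℕ.+ n) ≈ fromℕ m + fromℕ n
  fromℕ-+ = ×-homo-+ 1#

  fromℕ-* : ∀ m n → fromℕ (m ℕ.* n) ≈ fromℕ m * fromℕ n
  fromℕ-* = ×1-homo-*

  fromℕ-^ : ∀ m n → fromℕ (m ℕ.^ n) ≈ fromℕ m ^ n
  fromℕ-^ m zero    = refl
  fromℕ-^ m (suc n) = trans (fromℕ-* m (m ℕ.^ n)) (*-congˡ (fromℕ-^ m n))

  signed : Sign → Carrier → Carrier
  signed Sign.+ x = x
  signed Sign.- x = - x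

  fromℤ : ℤ → Carrier
  fromℤ i = signed (ℤ.sign i) (fromℕ ℤ.∣ i ∣)

  signed-cong : ∀ s {x y} → x ≈ y → signed s x ≈ signed s y
  signed-cong Sign.+ x≈y = x≈y
  signed-cong Sign.- x≈y = -‿cong x≈y

  signed-* : ∀ s t x y → signed (s Sign.* t) (x * y) ≈ signed s x * signed t y
  signed-* Sign.+ Sign.+ x y = refl
  signed-* Sign.+ Sign.- x y = -‿distribʳ-* x y
  signed-* Sign.- Sign.+ x y = -‿distribˡ-* x y
  signed-* Sign.- Sign.- x y = begin
    x * y         ≈⟨ -‿involutive (x * y) ⟨
    - - (x * y)   ≈⟨ -‿cong (-‿distribˡ-* x y) ⟩
    - (- x * y)   ≈⟨ -‿distribʳ-* (- x) y ⟩
    - x * - y     ∎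

  fromℤ-◃ : ∀ s n → fromℤ (s ℤ.◃ n) ≈ signed s (fromℕ n)
  fromℤ-◃ Sign.+ zero    = refl
  fromℤ-◃ Sign.- zero    = sym ε⁻¹≈ε
  fromℤ-◃ Sign.+ (suc n) = refl
  fromℤ-◃ Sign.- (suc n) = refl

  fromℤ-⊖ : ∀ m n → fromℤ (m ℤ.⊖ n) ≈ fromℕ m - fromℕ n
  fromℤ-⊖ m zero = begin
    fromℤ (m ℤ.⊖ 0)  ≡⟨ ≡.cong fromℤ (ℤ.⊖-≥ {m} ℕ.z≤n) ⟩
    fromℕ m          ≈⟨ +-identityʳ (fromℕ m) ⟨
    fromℕ m + 0#     ≈⟨ +-congˡ ε⁻¹≈ε ⟨
    fromℕ m - 0#     ∎
  fromℤ-⊖ zero (suc n) = begin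
    fromℤ (0 ℤ.⊖ suc n)   ≡⟨ ≡.cong fromℤ (ℤ.⊖-< {0} {suc n} (ℕ.s≤s ℕ.z≤n)) ⟩
    - fromℕ (suc n)       ≈⟨ +-identityˡ _ ⟨
    0# - fromℕ (suc n)    ∎
  fromℤ-⊖ (suc m) (suc n) = begin
    fromℤ (suc m ℤ.⊖ suc n)               ≡⟨ ≡.cong fromℤ (ℤ.[1+m]⊖[1+n]≡m⊖n m n) ⟩
    fromℤ (m ℤ.⊖ n)                       ≈⟨ fromℤ-⊖ m n ⟩
    fromℕ m - fromℕ n                     ≈⟨ +-identityˡ _ ⟨
    0# + (fromℕ m - fromℕ n)              ≈⟨ +-congʳ (-‿inverseʳ 1#) ⟨
    (1# - 1#) + (fromℕ m - fromℕ n)       ≈⟨ interchange 1# (- 1#) (fromℕ m) (- fromℕ n) ⟩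
    (1# + fromℕ m) + (- 1# - fromℕ n)     ≈⟨ +-congˡ (⁻¹-∙-comm 1# (fromℕ n)) ⟩
    (1# + fromℕ m) - (1# + fromℕ n)       ≈⟨ +-cong (fromℕ-suc m) (-‿cong (fromℕ-suc n)) ⟨
    fromℕ (suc m) - fromℕ (suc n)         ∎

  fromℤ-+ : ∀ i j → fromℤ (i ℤ.+ j) ≈ fromℤ i + fromℤ j
  fromℤ-+ (+ m)    (+ n)    = fromℕ-+ m n
  fromℤ-+ (+ m)    -[1+ n ] = fromℤ-⊖ m (suc n)
  fromℤ-+ -[1+ m ] (+ n)    = trans (fromℤ-⊖ n (suc m)) (+-comm _ _)
  fromℤ-+ -[1+ m ] -[1+ n ] = begin
    - fromℕ (suc (suc (m ℕ.+ n)))        ≡⟨ ≡.cong (λ k → - fromℕ (suc k)) (ℕ.+-suc m n) ⟨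
    - fromℕ (suc m ℕ.+ suc n)            ≈⟨ -‿cong (fromℕ-+ (suc m) (suc n)) ⟩
    - (fromℕ (suc m) + fromℕ (suc n))    ≈⟨ ⁻¹-∙-comm _ _ ⟨
    - fromℕ (suc m) - fromℕ (suc n)      ∎

  fromℤ-* : ∀ i j → fromℤ (i ℤ.* j) ≈ fromℤ i * fromℤ j
  fromℤ-* i j = begin
    fromℤ (i ℤ.* j)                                       ≈⟨ fromℤ-◃ (s Sign.* t) (ℤ.∣ i ∣ ℕ.* ℤ.∣ j ∣) ⟩
    signed (s Sign.* t) (fromℕ (ℤ.∣ i ∣ ℕ.* ℤ.∣ j ∣))     ≈⟨ signed-cong (s Sign.* t) (fromℕ-* ℤ.∣ i ∣ ℤ.∣ j ∣) ⟩
    signed (s Sign.* t) (fromℕ ℤ.∣ i ∣ * fromℕ ℤ.∣ j ∣)   ≈⟨ signed-* s t _ _ ⟩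
    fromℤ i * fromℤ j                                     ∎
    where
    s = ℤ.sign i
    t = ℤ.sign j

  fromℤ-neg : ∀ i → fromℤ (ℤ.- i) ≈ - fromℤ i
  fromℤ-neg (+ zero)  = sym ε⁻¹≈ε
  fromℤ-neg (+ suc n) = refl
  fromℤ-neg -[1+ n ]  = sym (-‿involutive _)

  fromℤ-homomorphism : ℤ.+-*-rawRing -Raw-AlmostCommutative⟶ fromCommutativeRing R
  fromℤ-homomorphism = record
    { ⟦_⟧    = fromℤ
    ; +-homo = fromℤ-+
    ; *-homo = fromℤ-*
    ; -‿homo = fromℤ-neg
    ; 0-homo = refl
    ; 1-homo = refl
    }

  fromℤ-≟ : ∀ i j → Maybe (fromℤ i ≈ fromℤ j)
  fromℤ-≟ i j with i ℤ.≟ j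
  ... | yes ≡.refl = just refl
  ... | no _       = nothing

  open import Algebra.Solver.Ring ℤ.+-*-rawRing (fromCommutativeRing R) fromℤ-homomorphism fromℤ-≟ public
    using (solve; _:=_; con; _:+_; _:*_; _:-_; :-_; _:^_)

module Frobenius {c ℓ} (R : CommutativeRing c ℓ) where
  open import Data.Nat.Primality using (¬prime[0])
  open import Data.Nat.Combinatorics using (nCn≡1)
  open CommutativeRing R hiding (zero)
  open IntegerCoefficients R using (fromℕ; fromℕ-*)
  open import Algebra.Properties.Semiring.Mult semiring using (_×_; ×-assoc-*; ×-congʳ)
  open import Algebra.Properties.Monoid.Mult.TCOptimised +-monoid using (×ᵤ≈×)
  open import Algebra.Properties.CommutativeSemiring.Binomial commutativeSemiring using (theorem; binomialTerm)
  open import Algebra.Properties.CommutativeMonoid.Sum +-commutativeMonoid using (sum; sum-init-last; sum-cong-≋; sum-replicate-zero)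
  open import Algebra.Properties.Semiring.Exp semiring using (_^_; ^-congˡ; ^-assocʳ)
  open import Relation.Binary.Reasoning.Setoid setoid

  p-multiple×≈0 : ∀ {p n} → fromℕ p ≈ 0# → ∀ z → p ∣ n → n × z ≈ 0#
  p-multiple×≈0 {p} p≈0 z (divides j ≡.refl) = begin
    (j ℕ.* p) × z           ≈⟨ ×-congʳ (j ℕ.* p) (*-identityˡ z) ⟨
    (j ℕ.* p) × (1# * z)    ≈⟨ ×-assoc-* (j ℕ.* p) 1# z ⟨
    ((j ℕ.* p) × 1#) * z    ≈⟨ *-congʳ (×ᵤ≈× (j ℕ.* p) 1#) ⟩
    fromℕ (j ℕ.* p) * z     ≈⟨ *-congʳ (fromℕ-* j p) ⟩
    fromℕ j * fromℕ p * z   ≈⟨ *-congʳ (trans (*-congˡ p≈0) (zeroʳ _)) ⟩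
    0# * z                  ≈⟨ zeroˡ z ⟩
    0#                      ∎

  frobenius : ∀ {p} → Prime p → fromℕ p ≈ 0# → ∀ x y → (x + y) ^ p ≈ x ^ p + y ^ p
  frobenius {zero}  p-prime = contradiction p-prime ¬prime[0]
  frobenius {suc m} p-prime p≈0 x y = begin
    (x + y) ^ suc m                                ≈⟨ theorem (suc m) x y ⟩
    T zero + sum (T ∘ suc)                         ≈⟨ +-congˡ (sum-init-last (T ∘ suc)) ⟩
    T zero + (sum (T ∘ suc ∘ Fin.inject₁) + T (suc (Fin.fromℕ m)))
                                                   ≈⟨ +-cong first (+-cong middle (last (Fin.toℕ (suc (Fin.fromℕ m))) (Fin.toℕ-fromℕ (suc m)))) ⟩
    y ^ suc m + (0# + x ^ suc m)                   ≈⟨ +-congˡ (+-identityˡ _) ⟩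
    y ^ suc m + x ^ suc m                          ≈⟨ +-comm _ _ ⟩
    x ^ suc m + y ^ suc m                          ∎
    where
    T = binomialTerm x y (suc m)
    first : T zero ≈ y ^ suc m
    first = trans (+-identityʳ _) (*-identityˡ _)
    middle : sum (T ∘ suc ∘ Fin.inject₁) ≈ 0#
    middle = trans (sum-cong-≋ vanishes) (sum-replicate-zero m)
      where
      vanishes : ∀ i → T (suc (Fin.inject₁ i)) ≈ 0#
      vanishes i = p-multiple×≈0 p≈0 _ (p∣pCk p-prime (ℕ.s≤s ℕ.z≤n) (ℕ.s≤s (Fin.inject₁ℕ< i)))
    -- stated for any k ≡ suc m, as Fin.toℕ (Fin.fromℕ m) ≡ m holds only propositionally
    last : ∀ k → k ≡ suc m → (suc m C k) × (x ^ k * y ^ (suc m ∸ k)) ≈ x ^ suc m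
    last _ ≡.refl = begin
      (suc m C suc m) × (x ^ suc m * y ^ (suc m ∸ suc m)) ≡⟨ ≡.cong₂ (λ a b → a × (x ^ suc m * y ^ b)) (nCn≡1 (suc m)) (ℕ.n∸n≡0 m) ⟩
      1 × (x ^ suc m * 1#)                                ≈⟨ trans (+-identityʳ _) (*-identityʳ _) ⟩
      x ^ suc m                                           ∎

  frobenius-^ : ∀ {p} → Prime p → fromℕ p ≈ 0# → ∀ k x y → (x + y) ^ (p ℕ.^ k) ≈ x ^ (p ℕ.^ k) + y ^ (p ℕ.^ k)
  frobenius-^     p-prime p≈0 zero    x y = trans (*-identityʳ _) (sym (+-cong (*-identityʳ x) (*-identityʳ y)))
  frobenius-^ {p} p-prime p≈0 (suc k) x y = begin
    (x + y) ^ (p ℕ.* p ℕ.^ k)                    ≈⟨ ^-assocʳ (x + y) p (p ℕ.^ k) ⟨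
    ((x + y) ^ p) ^ (p ℕ.^ k)                    ≈⟨ ^-congˡ (p ℕ.^ k) (frobenius p-prime p≈0 x y) ⟩
    (x ^ p + y ^ p) ^ (p ℕ.^ k)                  ≈⟨ frobenius-^ p-prime p≈0 k (x ^ p) (y ^ p) ⟩
    (x ^ p) ^ (p ℕ.^ k) + (y ^ p) ^ (p ℕ.^ k)    ≈⟨ +-cong (^-assocʳ x p (p ℕ.^ k)) (^-assocʳ y p (p ℕ.^ k)) ⟩
    x ^ (p ℕ.* p ℕ.^ k) + y ^ (p ℕ.* p ℕ.^ k)    ∎

module FieldProperties {c ℓ} (F : Field c ℓ) where
  open import Data.Integer.Base using (+_)
  open import Data.Nat.Coprimality using (prime⇒coprime; coprime-Bézout)
  open import Data.Nat.DivMod using (_%_; _/_; m≡m%n+[m/n]*n)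
  import Data.Nat.GCD as GCD
  import Algebra.Properties.CommutativeMonoid.Sum
  open Field F hiding (zero)
  open import Algebra.Properties.Group +-group using (x∙y⁻¹≈ε⇒x≈y; x≈y⇒x∙y⁻¹≈ε; inverseˡ-unique; ε⁻¹≈ε)
  open import Algebra.Properties.Ring ring using (-‿involutive)
  open import Algebra.Properties.Semiring.Exp semiring using (^-congˡ; ^-homo-*; ^-assocʳ)
  open import Relation.Binary.Reasoning.Setoid setoid
  open IntegerCoefficients commRing public
    using (fromℕ; fromℕ-suc; fromℕ-+; fromℕ-*; fromℕ-^; solve; _:=_; con; _:+_; _:*_; _:-_; :-_; _:^_)
  private
    module Π = Algebra.Properties.CommutativeMonoid.Sum *-commutativeMonoid

  1≉0 : 1# ≉ 0#
  1≉0 1≈0 = 0≉1 (sym 1≈0)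

  -1≉0 : - 1# ≉ 0#
  -1≉0 -1≈0 = 1≉0 (trans (sym (-‿involutive 1#)) (trans (-‿cong -1≈0) ε⁻¹≈ε))

  -x*-y≈x*y : ∀ x y → - x * - y ≈ x * y
  -x*-y≈x*y x y = solve 2 (λ x y → :- x :* :- y := x :* y) refl x y

  inv : ∀ x → x ≉ 0# → Carrier
  inv x x≉0 = proj₁ (inverse x x≉0)

  *-inverseʳ : ∀ x (x≉0 : x ≉ 0#) → x * inv x x≉0 ≈ 1#
  *-inverseʳ x x≉0 = proj₂ (inverse x x≉0)

  *-inverseˡ : ∀ x (x≉0 : x ≉ 0#) → inv x x≉0 * x ≈ 1#
  *-inverseˡ x x≉0 = trans (*-comm _ x) (*-inverseʳ x x≉0)

  *-cancelˡ : ∀ {x y z} → x ≉ 0# → x * y ≈ x * z → y ≈ z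
  *-cancelˡ {x} {y} {z} x≉0 xy≈xz = begin
    y                   ≈⟨ *-identityˡ y ⟨
    1# * y              ≈⟨ *-congʳ (*-inverseˡ x x≉0) ⟨
    (inv x x≉0 * x) * y ≈⟨ *-assoc _ x y ⟩
    inv x x≉0 * (x * y) ≈⟨ *-congˡ xy≈xz ⟩
    inv x x≉0 * (x * z) ≈⟨ *-assoc _ x z ⟨
    (inv x x≉0 * x) * z ≈⟨ *-congʳ (*-inverseˡ x x≉0) ⟩
    1# * z              ≈⟨ *-identityˡ z ⟩
    z                   ∎

  *-inverse-unique : ∀ {x y} (x≉0 : x ≉ 0#) → x * y ≈ 1# → y ≈ inv x x≉0
  *-inverse-unique {x} x≉0 xy≈1 = *-cancelˡ x≉0 (trans xy≈1 (sym (*-inverseʳ x x≉0)))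

  x*y≈0⇒y≈0 : ∀ {x y} → x ≉ 0# → x * y ≈ 0# → y ≈ 0#
  x*y≈0⇒y≈0 {x} x≉0 xy≈0 = *-cancelˡ x≉0 (trans xy≈0 (sym (zeroʳ x)))

  *-nonzero : ∀ {x y} → x ≉ 0# → y ≉ 0# → x * y ≉ 0#
  *-nonzero x≉0 y≉0 xy≈0 = y≉0 (x*y≈0⇒y≈0 x≉0 xy≈0)

  ∏-nonzero : ∀ {n} (f : Fin n → Carrier) → (∀ i → f i ≉ 0#) → Π.sum f ≉ 0#
  ∏-nonzero {zero}  f f≉0 = 1≉0
  ∏-nonzero {suc n} f f≉0 = *-nonzero (f≉0 zero) (∏-nonzero (f ∘ suc) (f≉0 ∘ suc))

  ^-nonzero : ∀ {x} n → x ≉ 0# → x ^ n ≉ 0#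
  ^-nonzero zero    x≉0 = 1≉0
  ^-nonzero (suc n) x≉0 = *-nonzero x≉0 (^-nonzero n x≉0)

  1^n≈1 : ∀ n → 1# ^ n ≈ 1#
  1^n≈1 zero    = refl
  1^n≈1 (suc n) = trans (*-identityˡ _) (1^n≈1 n)

  ^-% : ∀ {x} m n .{{_ : ℕ.NonZero n}} → x ^ n ≈ 1# → x ^ m ≈ x ^ (m % n)
  ^-% {x} m n xⁿ≈1 = begin
    x ^ m                                 ≡⟨ ≡.cong (x ^_) (≡.trans (m≡m%n+[m/n]*n m n) (≡.cong (m % n ℕ.+_) (ℕ.*-comm (m / n) n))) ⟩
    x ^ (m % n ℕ.+ n ℕ.* (m / n))         ≈⟨ ^-homo-* x (m % n) (n ℕ.* (m / n)) ⟩
    x ^ (m % n) * x ^ (n ℕ.* (m / n))     ≈⟨ *-congˡ (^-assocʳ x n (m / n)) ⟨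
    x ^ (m % n) * (x ^ n) ^ (m / n)       ≈⟨ *-congˡ (trans (^-congˡ (m / n) xⁿ≈1) (1^n≈1 (m / n))) ⟩
    x ^ (m % n) * 1#                      ≈⟨ *-identityʳ _ ⟩
    x ^ (m % n)                           ∎

  x*x≈1⇒x≈-1 : ∀ {x} → x ≉ 1# → x * x ≈ 1# → x ≈ - 1#
  x*x≈1⇒x≈-1 {x} x≉1 x*x≈1 = inverseˡ-unique x 1# (x*y≈0⇒y≈0 (x≉1 ∘ x∙y⁻¹≈ε⇒x≈y x 1#) (begin
    (x - 1#) * (x + 1#)  ≈⟨ solve 1 (λ x → (x :- con (+ 1)) :* (x :+ con (+ 1)) := x :* x :- con (+ 1)) refl x ⟩
    x * x - 1#           ≈⟨ x≈y⇒x∙y⁻¹≈ε x*x≈1 ⟩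
    0#                   ∎))

  1+ua≢vb : ∀ {a b} u v → fromℕ a ≈ 0# → fromℕ b ≈ 0# → 1 ℕ.+ u ℕ.* a ≢ v ℕ.* b
  1+ua≢vb {a} {b} u v a≈0 b≈0 eq = 1≉0 (begin
    1#                        ≈⟨ +-identityʳ 1# ⟨
    1# + 0#                   ≈⟨ +-congˡ (trans (*-congˡ a≈0) (zeroʳ _)) ⟨
    1# + fromℕ u * fromℕ a    ≈⟨ +-congˡ (fromℕ-* u a) ⟨
    fromℕ 1 + fromℕ (u ℕ.* a) ≈⟨ fromℕ-+ 1 (u ℕ.* a) ⟨
    fromℕ (1 ℕ.+ u ℕ.* a)     ≡⟨ ≡.cong fromℕ eq ⟩
    fromℕ (v ℕ.* b)           ≈⟨ fromℕ-* v b ⟩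
    fromℕ v * fromℕ b         ≈⟨ trans (*-congˡ b≈0) (zeroʳ _) ⟩
    0#                        ∎)

  fromℕ≉0 : ∀ {p n} → Prime p → fromℕ p ≈ 0# → .{{ℕ.NonZero n}} → n ℕ.< p → fromℕ n ≉ 0#
  fromℕ≉0 p-prime p≈0 n<p n≈0 with coprime-Bézout (prime⇒coprime p-prime n<p)
  ... | GCD.Bézout.+- x y eq = 1+ua≢vb y x n≈0 p≈0 eq
  ... | GCD.Bézout.-+ x y eq = 1+ua≢vb x y p≈0 n≈0 eq

  -- A² + AB + B² ≈ (A - ζB)(A - ζ²B), and (A , B) ↦ (A - ζB , A - ζ²B) is invertible:
  -- Preimage Z Z′ is the pair mapped to (Z , Z′).
  module CubeRootCoordinates {ζ} (ζ³≈1 : ζ ^ 3 ≈ 1#) (ζ≉1 : ζ ≉ 1#) where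

    ζ-1≉0 : ζ - 1# ≉ 0#
    ζ-1≉0 ζ-1≈0 = ζ≉1 (x∙y⁻¹≈ε⇒x≈y ζ 1# ζ-1≈0)

    1+ζ+ζ²≈0 : 1# + ζ + ζ * ζ ≈ 0#
    1+ζ+ζ²≈0 = x*y≈0⇒y≈0 ζ-1≉0 (begin
      (ζ - 1#) * (1# + ζ + ζ * ζ)   ≈⟨ solve 1 (λ z → (z :- con (+ 1)) :* (con (+ 1) :+ z :+ z :* z) := z :^ 3 :- con (+ 1)) refl ζ ⟩
      ζ ^ 3 - 1#                    ≈⟨ x≈y⇒x∙y⁻¹≈ε ζ³≈1 ⟩
      0#                            ∎)

    ζ²-ζ≉0 : ζ * ζ - ζ ≉ 0#
    ζ²-ζ≉0 ζ²-ζ≈0 = *-nonzero ζ≉0 ζ-1≉0 (trans (solve 1 (λ z → z :* (z :- con (+ 1)) := z :* z :- z) refl ζ) ζ²-ζ≈0)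
      where
      ζ≉0 : ζ ≉ 0#
      ζ≉0 ζ≈0 = 1≉0 (trans (sym ζ³≈1) (trans (*-congʳ ζ≈0) (zeroˡ _)))

    module Preimage (Z Z′ : Carrier) where
      A B : Carrier
      A = inv (ζ * ζ - ζ) ζ²-ζ≉0 * (ζ * ζ * Z - ζ * Z′)
      B = inv (ζ * ζ - ζ) ζ²-ζ≉0 * (Z - Z′)

      private
        s⁻¹ = inv (ζ * ζ - ζ) ζ²-ζ≉0
        cancel : ∀ x → x * ((ζ * ζ - ζ) * s⁻¹) ≈ x
        cancel x = trans (*-congˡ (*-inverseʳ _ ζ²-ζ≉0)) (*-identityʳ x)

      A-ζB≈Z : A - ζ * B ≈ Z
      A-ζB≈Z = trans (solve 4 (λ z Z Z′ i → i :* (z :* z :* Z :- z :* Z′) :- z :* (i :* (Z :- Z′))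
                                      := Z :* ((z :* z :- z) :* i)) refl ζ Z Z′ s⁻¹) (cancel Z)

      A-ζ²B≈Z′ : A - ζ * ζ * B ≈ Z′
      A-ζ²B≈Z′ = trans (solve 4 (λ z Z Z′ i → i :* (z :* z :* Z :- z :* Z′) :- z :* z :* (i :* (Z :- Z′))
                                       := Z′ :* ((z :* z :- z) :* i)) refl ζ Z Z′ s⁻¹) (cancel Z′)

      A²+AB+B²≈ZZ′ : A * A + A * B + B * B ≈ Z * Z′
      A²+AB+B²≈ZZ′ = begin
        A * A + A * B + B * B
          ≈⟨ solve 3 (λ a b z → a :* a :+ a :* b :+ b :* b
                                := (a :- z :* b) :* (a :- z :* z :* b) :+ (con (+ 1) :+ z :+ z :* z) :* (a :* b) :- (z :^ 3 :- con (+ 1)) :* (b :* b)) refl A B ζ ⟩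
        (A - ζ * B) * (A - ζ * ζ * B) + (1# + ζ + ζ * ζ) * (A * B) - (ζ ^ 3 - 1#) * (B * B)
          ≈⟨ +-cong (+-cong (*-cong A-ζB≈Z A-ζ²B≈Z′) (*-congʳ 1+ζ+ζ²≈0)) (-‿cong (*-congʳ (x≈y⇒x∙y⁻¹≈ε ζ³≈1))) ⟩
        Z * Z′ + 0# * (A * B) - 0# * (B * B)
          ≈⟨ solve 4 (λ Z Z′ x y → Z :* Z′ :+ con (+ 0) :* x :- con (+ 0) :* y := Z :* Z′) refl Z Z′ (A * B) (B * B) ⟩
        Z * Z′ ∎

      A≈B⇒Z≈-ζZ′ : A ≈ B → Z ≈ - (ζ * Z′)
      A≈B⇒Z≈-ζZ′ A≈B = inverseˡ-unique Z (ζ * Z′) (begin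
        Z + ζ * Z′                                 ≈⟨ +-cong A-ζB≈Z (*-congˡ A-ζ²B≈Z′) ⟨
        (A - ζ * B) + ζ * (A - ζ * ζ * B)          ≈⟨ +-cong (+-congʳ A≈B) (*-congˡ (+-congʳ A≈B)) ⟩
        (B - ζ * B) + ζ * (B - ζ * ζ * B)          ≈⟨ solve 2 (λ b z → (b :- z :* b) :+ z :* (b :- z :* z :* b) := (con (+ 1) :- z :^ 3) :* b) refl B ζ ⟩
        (1# - ζ ^ 3) * B                           ≈⟨ *-congʳ (x≈y⇒x∙y⁻¹≈ε (sym ζ³≈1)) ⟩
        0# * B                                     ≈⟨ zeroˡ B ⟩
        0#                                         ∎)

module MonicPolynomials {c ℓ} (F : Field c ℓ) where
  open import Data.Empty using (⊥)
  open import Data.Integer.Base using (+_)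
  open import Data.Product.Base using (_×_)
  open import Data.Vec.Base using (Vec; []; _∷_)
  open Field F hiding (zero)
  open FieldProperties F
  open import Algebra.Properties.Group +-group using (x∙y⁻¹≈ε⇒x≈y)
  open import Relation.Binary.Reasoning.Setoid setoid

  -- `a₀ ∷ … ∷ aₙ₋₁ ∷ []` stands for the monic polynomial a₀ + a₁ X + … + aₙ₋₁ Xⁿ⁻¹ + Xⁿ.
  eval : ∀ {n} → Vec Carrier n → Carrier → Carrier
  eval []       x = 1#
  eval (a ∷ as) x = a + x * eval as x

  divide : ∀ {n} → Vec Carrier (suc n) → Carrier → Vec Carrier n × Carrier
  divide (a ∷ [])         r = [] , a + r
  divide (a ∷ as@(_ ∷ _)) r =
    let (quotient , remainder) = divide as r in remainder ∷ quotient , a + r * remainder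

  eval-divide : ∀ {n} (P : Vec Carrier (suc n)) r x →
                eval P x ≈ (x - r) * eval (proj₁ (divide P r)) x + proj₂ (divide P r)
  eval-divide (a ∷ []) r x =
    solve 3 (λ a r x → a :+ x :* con (+ 1) := (x :- r) :* con (+ 1) :+ (a :+ r)) refl a r x
  eval-divide (a ∷ as@(_ ∷ _)) r x = begin
    a + x * eval as x          ≈⟨ +-congˡ (*-congˡ (eval-divide as r x)) ⟩
    a + x * ((x - r) * Q + s)  ≈⟨ solve 5 (λ a r x Q s → a :+ x :* ((x :- r) :* Q :+ s)
                                        := (x :- r) :* (s :+ x :* Q) :+ (a :+ r :* s)) refl a r x Q s ⟩
    (x - r) * (s + x * Q) + (a + r * s) ∎
    where
    Q = eval (proj₁ (divide as r)) x
    s = proj₂ (divide as r)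

  roots-bounded : ∀ {n} (P : Vec Carrier n) (r : Fin (suc n) → Carrier) →
                  (∀ {i j} → r i ≈ r j → i ≡ j) → (∀ i → eval P (r i) ≈ 0#) → ⊥
  roots-bounded []        r r-injective roots = 1≉0 (roots zero)
  roots-bounded P@(_ ∷ _) r r-injective roots =
    roots-bounded Q (r ∘ suc) (Fin.suc-injective ∘ r-injective) Q-roots
    where
    Q = proj₁ (divide P (r zero))
    s = proj₂ (divide P (r zero))
    at : ∀ x → eval P x ≈ (x - r zero) * eval Q x + s
    at = eval-divide P (r zero)
    s≈0 : s ≈ 0#
    s≈0 = begin
      s                                        ≈⟨ +-identityˡ s ⟨
      0# + s                                   ≈⟨ +-congʳ (trans (*-congʳ (-‿inverseʳ (r zero))) (zeroˡ _)) ⟨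
      (r zero - r zero) * eval Q (r zero) + s  ≈⟨ at (r zero) ⟨
      eval P (r zero)                          ≈⟨ roots zero ⟩
      0#                                       ∎
    Q-roots : ∀ i → eval Q (r (suc i)) ≈ 0#
    Q-roots i = x*y≈0⇒y≈0 (λ d≈0 → Fin.0≢1+n (r-injective (sym (x∙y⁻¹≈ε⇒x≈y _ _ d≈0)))) (begin
      (r (suc i) - r zero) * eval Q (r (suc i))       ≈⟨ +-identityʳ _ ⟨
      (r (suc i) - r zero) * eval Q (r (suc i)) + 0#  ≈⟨ +-congˡ s≈0 ⟨
      (r (suc i) - r zero) * eval Q (r (suc i)) + s   ≈⟨ at (r (suc i)) ⟨
      eval P (r (suc i))                              ≈⟨ roots (suc i) ⟩
      0#                                              ∎)

module FiniteField {c ℓ} (F : Field c ℓ) {N : ℕ} (card : HasCard F N) where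
  open import Data.Fin.Permutation using (Permutation; permutation)
  open import Data.Integer.Base using (+_)
  open import Data.Product.Base using (_×_)
  open import Data.Vec.Base using (Vec; _∷_; replicate)
  open import Function.Bundles using (Bijection; Surjection)
  open import Relation.Binary.Definitions using (Decidable)
  open import Relation.Nullary.Decidable using (map′; decidable-stable)
  import Algebra.Properties.CommutativeMonoid.Sum as Sum
  open Field F hiding (zero)
  open FieldProperties F
  open MonicPolynomials F using (eval; roots-bounded)
  open import Algebra.Properties.Group +-group using (loop; x≈y⇒x∙y⁻¹≈ε)
  open import Algebra.Properties.Loop loop using (identityʳ-unique)
  open import Algebra.Properties.Monoid.Mult.TCOptimised +-monoid using (×ᵤ≈×)
  open import Algebra.Properties.Semiring.Exp semiring using (^-congˡ; ^-assocʳ)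
  open import Relation.Binary.Reasoning.Setoid setoid

  index : Carrier → Fin N
  index = Bijection.to card

  element : Fin N → Carrier
  element = Bijection.to⁻ card

  index-element : ∀ i → index (element i) ≡ i
  index-element = Surjection.to∘to⁻ (Bijection.surjection card)

  element-index : ∀ x → element (index x) ≈ x
  element-index x = Bijection.injective card (index-element (index x))

  element-injective : ∀ {i j} → element i ≈ element j → i ≡ j
  element-injective {i} {j} eq =
    ≡.trans (≡.sym (index-element i)) (≡.trans (Bijection.cong card eq) (index-element j))

  infix 4 _≟_
  _≟_ : Decidable _≈_
  x ≟ y = map′ (Bijection.injective card) (Bijection.cong card) (index x Fin.≟ index y)

  x^n≈0⇒x≈0 : ∀ {x} n → x ^ n ≈ 0# → x ≈ 0#
  x^n≈0⇒x≈0 {x} n xⁿ≈0 = decidable-stable (x ≟ 0#) (λ x≉0 → ^-nonzero n x≉0 xⁿ≈0)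

  injective⇒surjective : ∀ {h} → Congruent _≈_ _≈_ h → Injective _≈_ _≈_ h → Surjective _≈_ _≈_ h
  injective⇒surjective {h} h-cong h-injective y =
    let i , index[h[element-i]]≡index-y = fin-injective⇒surjective {g = index ∘ h ∘ element}
                                            (element-injective ∘ h-injective ∘ Bijection.injective card) (index y)
    in element i , λ z≈element-i → trans (h-cong z≈element-i) (Bijection.injective card index[h[element-i]]≡index-y)

  module Reindex (σ τ : Carrier → Carrier) (σ-cong : Congruent _≈_ _≈_ σ) (τ-cong : Congruent _≈_ _≈_ τ)
                 (σ∘τ : ∀ x → σ (τ x) ≈ x) (τ∘σ : ∀ x → τ (σ x) ≈ x) where

    σ-permutation : Permutation N N
    σ-permutation = permutation (λ i → index (σ (element i))) (λ i → index (τ (element i)))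
      (λ i → ≡.trans (Bijection.cong card (trans (σ-cong (element-index _)) (σ∘τ _))) (index-element i))
      (λ i → ≡.trans (Bijection.cong card (trans (τ-cong (element-index _)) (τ∘σ _))) (index-element i))

    sum-reindex : ∀ {m ℓm} (M : CommutativeMonoid m ℓm) (h : Carrier → CommutativeMonoid.Carrier M) →
                  (∀ {x y} → x ≈ y → CommutativeMonoid._≈_ M (h x) (h y)) →
                  CommutativeMonoid._≈_ M (Sum.sum M (h ∘ element)) (Sum.sum M (h ∘ σ ∘ element))
    sum-reindex M h h-cong = M.trans (Sum.sum-permute M (h ∘ element) σ-permutation)
                                     (Sum.sum-cong-≋ M (λ i → h-cong (element-index (σ (element i)))))
      where module M = CommutativeMonoid M

  instance
    N-nonZero : ℕ.NonZero N
    N-nonZero = Fin.nonZeroIndex (index 0#)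

  characteristic : fromℕ N ≈ 0#
  characteristic = identityʳ-unique S (fromℕ N) (sym (begin
    S                              ≈⟨ Translation.sum-reindex +-commutativeMonoid (λ x → x) (λ x≈y → x≈y) ⟩
    Σ.sum (λ i → element i + 1#)   ≈⟨ Σ.∑-distrib-+ {N} element (λ _ → 1#) ⟩
    S + Σ.sum {N} (λ _ → 1#)       ≈⟨ +-congˡ (trans (Σ.sum-replicate N) (×ᵤ≈× N 1#)) ⟩
    S + fromℕ N                    ∎))
    where
    module Σ = Sum +-commutativeMonoid
    S = Σ.sum element
    module Translation = Reindex (_+ 1#) (_- 1#) +-congʳ +-congʳ
      (λ x → solve 1 (λ x → (x :- con (+ 1)) :+ con (+ 1) := x) refl x)
      (λ x → solve 1 (λ x → (x :+ con (+ 1)) :- con (+ 1) := x) refl x)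

  -- 0 is replaced by 1, so that the product of unit over the field is invertible
  unit : Carrier → Carrier
  unit x with x ≟ 0#
  ... | yes _ = 1#
  ... | no  _ = x

  unit-cong : Congruent _≈_ _≈_ unit
  unit-cong {x} {y} x≈y with x ≟ 0# | y ≟ 0#
  ... | yes _   | yes _   = refl
  ... | yes x≈0 | no  y≉0 = contradiction (trans (sym x≈y) x≈0) y≉0
  ... | no  x≉0 | yes y≈0 = contradiction (trans x≈y y≈0) x≉0
  ... | no  _   | no  _   = x≈y

  unit-nonzero : ∀ x → unit x ≉ 0#
  unit-nonzero x with x ≟ 0#
  ... | yes _   = 1≉0
  ... | no  x≉0 = x≉0

  module _ {a} (a≉0 : a ≉ 0#) where
    private
      module Π = Sum *-commutativeMonoid

      P : Carrier
      P = Π.sum (unit ∘ element)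

      a-at-0 : Carrier → Carrier
      a-at-0 x with x ≟ 0#
      ... | yes _ = a
      ... | no  _ = 1#

      scale-unit : ∀ x → a * unit x ≈ unit (a * x) * a-at-0 x
      scale-unit x with x ≟ 0# | a * x ≟ 0#
      ... | yes _   | yes _    = trans (*-identityʳ a) (sym (*-identityˡ a))
      ... | yes x≈0 | no  ax≉0 = contradiction (trans (*-congˡ x≈0) (zeroʳ a)) ax≉0
      ... | no  x≉0 | yes ax≈0 = contradiction ax≈0 (*-nonzero a≉0 x≉0)
      ... | no  _   | no  _    = sym (*-identityʳ _)

      ∏a-at-0 : Π.sum (a-at-0 ∘ element) ≈ a
      ∏a-at-0 = trans (sum-single *-monoid (a-at-0 ∘ element) (index 0#) away-from-0) at-0
        where
        away-from-0 : ∀ i → i ≢ index 0# → a-at-0 (element i) ≈ 1#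
        away-from-0 i i≢0 with element i ≟ 0#
        ... | yes i≈0 = contradiction (element-injective (trans i≈0 (sym (element-index 0#)))) i≢0
        ... | no  _   = refl
        at-0 : a-at-0 (element (index 0#)) ≈ a
        at-0 with element (index 0#) ≟ 0#
        ... | yes _   = refl
        ... | no  e≉0 = contradiction (element-index 0#) e≉0

      module Scaling = Reindex (a *_) (inv a a≉0 *_) *-congˡ *-congˡ
        (λ x → trans (sym (*-assoc _ _ x)) (trans (*-congʳ (*-inverseʳ a a≉0)) (*-identityˡ x)))
        (λ x → trans (sym (*-assoc _ _ x)) (trans (*-congʳ (*-inverseˡ a a≉0)) (*-identityˡ x)))

    fermat-nonzero : a ^ N ≈ a
    fermat-nonzero = *-cancelˡ (∏-nonzero (unit ∘ element) (unit-nonzero ∘ element)) (begin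
      P * a ^ N                                              ≈⟨ *-comm P _ ⟩
      a ^ N * P                                              ≈⟨ *-congʳ (Π.sum-replicate N) ⟨
      Π.sum (λ (_ : Fin N) → a) * P                          ≈⟨ Π.∑-distrib-+ {N} (λ _ → a) (unit ∘ element) ⟨
      Π.sum (λ i → a * unit (element i))                     ≈⟨ Π.sum-cong-≋ (scale-unit ∘ element) ⟩
      Π.sum (λ i → unit (a * element i) * a-at-0 (element i)) ≈⟨ Π.∑-distrib-+ (unit ∘ (a *_) ∘ element) (a-at-0 ∘ element) ⟩
      Π.sum (unit ∘ (a *_) ∘ element) * Π.sum (a-at-0 ∘ element)
                                                             ≈⟨ *-cong (Scaling.sum-reindex *-commutativeMonoid unit unit-cong) (sym ∏a-at-0) ⟨
      P * a                                                  ∎)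

  fermat : ∀ x → x ^ N ≈ x
  fermat x with x ≟ 0#
  ... | no  x≉0 = fermat-nonzero x≉0
  ... | yes x≈0 = begin
    x ^ N                  ≈⟨ ^-congˡ N x≈0 ⟩
    0# ^ N                 ≡⟨ ≡.cong (0# ^_) (ℕ.suc-pred N) ⟨
    0# * 0# ^ ℕ.pred N     ≈⟨ zeroˡ _ ⟩
    0#                     ≈⟨ x≈0 ⟨
    x                      ∎

  fermat-unit : ∀ {x} → x ≉ 0# → x ^ ℕ.pred N ≈ 1#
  fermat-unit {x} x≉0 = *-cancelˡ x≉0 (begin
    x * x ^ ℕ.pred N   ≡⟨ ≡.cong (x ^_) (ℕ.suc-pred N) ⟩
    x ^ N              ≈⟨ fermat x ⟩
    x                  ≈⟨ *-identityʳ x ⟨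
    x * 1#             ∎)

  ∃-non-root : ∀ {E} → 1 ℕ.≤ E → 2 ℕ.+ E ℕ.≤ N → ∃ λ a → a ≉ 0# × a ^ E ≉ 1#
  ∃-non-root {suc E} _ 3+E≤N = a , a≉0 , aᴱ≉1
    where
    X^[2+E]-X : Vec Carrier (2 ℕ.+ E)
    X^[2+E]-X = 0# ∷ - 1# ∷ replicate E 0#

    eval-Xⁿ : ∀ n x → eval (replicate n 0#) x ≈ x ^ n
    eval-Xⁿ zero    x = refl
    eval-Xⁿ (suc n) x = trans (+-identityˡ _) (*-congˡ (eval-Xⁿ n x))

    eval-X^[2+E]-X : ∀ x → eval X^[2+E]-X x ≈ x ^ (2 ℕ.+ E) - x
    eval-X^[2+E]-X x = begin
      0# + x * (- 1# + x * eval (replicate E 0#) x) ≈⟨ +-congˡ (*-congˡ (+-congˡ (*-congˡ (eval-Xⁿ E x)))) ⟩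
      0# + x * (- 1# + x * x ^ E)                   ≈⟨ solve 2 (λ x y → con (+ 0) :+ x :* (:- con (+ 1) :+ x :* y)
                                                              := x :* (x :* y) :- x) refl x (x ^ E) ⟩
      x * (x * x ^ E) - x                           ∎

    not-all-roots : ¬ (∀ i → element i ^ (2 ℕ.+ E) ≈ element i)
    not-all-roots all-roots = roots-bounded X^[2+E]-X (element ∘ inject)
      (λ eq → Fin.inject≤-injective 3+E≤N 3+E≤N _ _ (element-injective eq))
      (λ i → trans (eval-X^[2+E]-X _) (x≈y⇒x∙y⁻¹≈ε (all-roots (inject i))))
      where
      inject : Fin (3 ℕ.+ E) → Fin N
      inject i = Fin.inject≤ i 3+E≤N

    non-root : ∃ λ i → ¬ (element i ^ (2 ℕ.+ E) ≈ element i)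
    non-root = Fin.¬∀⟶∃¬ N _ (λ i → element i ^ (2 ℕ.+ E) ≟ element i) not-all-roots

    a : Carrier
    a = element (proj₁ non-root)

    a≉0 : a ≉ 0#
    a≉0 a≈0 = proj₂ non-root (begin
      a * a ^ suc E  ≈⟨ *-congʳ a≈0 ⟩
      0# * a ^ suc E ≈⟨ zeroˡ _ ⟩
      0#             ≈⟨ a≈0 ⟨
      a              ∎)

    aᴱ≉1 : a ^ suc E ≉ 1#
    aᴱ≉1 aᴱ≈1 = proj₂ non-root (trans (*-congˡ aᴱ≈1) (*-identityʳ a))

  2≤N : 2 ℕ.≤ N
  2≤N = Fin.injective⇒≤ {f = zero-and-one} zero-and-one-injective
    where
    zero-and-one : Fin 2 → Fin N
    zero-and-one zero    = index 0#
    zero-and-one (suc _) = index 1#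
    0≢1 : index 0# ≢ index 1#
    0≢1 eq = 0≉1 (Bijection.injective card eq)
    zero-and-one-injective : Injective _≡_ _≡_ zero-and-one
    zero-and-one-injective {zero}     {zero}     _  = ≡.refl
    zero-and-one-injective {zero}     {suc zero} eq = contradiction eq 0≢1
    zero-and-one-injective {suc zero} {zero}     eq = contradiction (≡.sym eq) 0≢1
    zero-and-one-injective {suc zero} {suc zero} _  = ≡.refl

  ∃-non-root-proper-divisor : ∀ {E n} → 2 ℕ.≤ n → ℕ.pred N ≡ E ℕ.* n → ∃ λ a → a ≉ 0# × a ^ E ≉ 1#
  ∃-non-root-proper-divisor {zero}      _   N-1≡0 = contradiction (≡.subst (1 ℕ.≤_) N-1≡0 (ℕ.pred-mono-≤ 2≤N)) λ ()
  ∃-non-root-proper-divisor {suc E} {n} 2≤n N-1≡[1+E]n = ∃-non-root (ℕ.s≤s ℕ.z≤n) (≡.subst (2 ℕ.+ suc E ℕ.≤_) N≡ 3+E≤1+[1+E]n)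
    where
    N≡ : suc (suc E ℕ.* n) ≡ N
    N≡ = ≡.trans (≡.cong suc (≡.sym N-1≡[1+E]n)) (ℕ.suc-pred N)
    3+E≤1+[1+E]n : 2 ℕ.+ suc E ℕ.≤ suc (suc E ℕ.* n)
    3+E≤1+[1+E]n = ℕ.≤-trans (ℕ.s≤s (ℕ.s≤s (ℕ.s≤s (ℕ.m≤m*n E 2)))) (ℕ.s≤s (ℕ.*-monoʳ-≤ (suc E) 2≤n))

  ∃-root-of-unity : ∀ {n} → 2 ℕ.≤ n → n ∣ ℕ.pred N → ∃ λ ζ → ζ ^ n ≈ 1# × ζ ≉ 1#
  ∃-root-of-unity {n} 2≤n (divides E N-1≡E*n) =
    let a , a≉0 , aᴱ≉1 = ∃-non-root-proper-divisor {E} 2≤n N-1≡E*n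
    in a ^ E , (begin
      (a ^ E) ^ n     ≈⟨ ^-assocʳ a E n ⟩
      a ^ (E ℕ.* n)   ≡⟨ ≡.cong (a ^_) N-1≡E*n ⟨
      a ^ ℕ.pred N    ≈⟨ fermat-unit a≉0 ⟩
      1#              ∎) , aᴱ≉1

  ∃-nonsquare : ∀ {E} → ℕ.pred N ≡ E ℕ.* 2 → ∃ λ a → a ^ E ≈ - 1#
  ∃-nonsquare {E} N-1≡2E =
    let a , a≉0 , aᴱ≉1 = ∃-non-root-proper-divisor {E} ℕ.≤-refl N-1≡2E
    in a , x*x≈1⇒x≈-1 aᴱ≉1 (begin
      a ^ E * a ^ E      ≈⟨ *-congˡ (*-identityʳ _) ⟨
      (a ^ E) ^ 2        ≈⟨ ^-assocʳ a E 2 ⟩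
      a ^ (E ℕ.* 2)      ≡⟨ ≡.cong (a ^_) N-1≡2E ⟨
      a ^ ℕ.pred N       ≈⟨ fermat-unit a≉0 ⟩
      1#                 ∎)

module QuadraticExtension {c ℓ} (F : Field c ℓ) {p k q : ℕ} (p-prime : Prime p) (p≢2 : p ≢ 2)
                          (q≡p^[1+k] : q ≡ p ℕ.^ suc k) (card : HasCard F (q ℕ.* q)) where
  open import Data.Empty using (⊥-elim)
  open import Data.Integer.Base using (+_)
  open import Data.Nat.Base using (_%_; _/_)
  open import Data.Nat.DivMod using (m≡m%n+[m/n]*n; m%n<n; %-distribˡ-*)
  open import Data.Nat.Divisibility using (m%n≡0⇒n∣m; n∣m⇒m%n≡0)
  open import Data.Nat.Primality using (prime[2]; prime⇒irreducible; prime⇒nonTrivial; prime?)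
  open import Data.Product.Base using (_×_)
  open import Data.Sum.Base using (_⊎_)
  open import Level using (_⊔_)
  open import Relation.Nullary.Decidable using (Dec; from-yes; decidable-stable)
  open Field F hiding (zero)
  open FieldProperties F
  open FiniteField F card
  open Frobenius commRing using (frobenius-^)
  open import Algebra.Properties.AbelianGroup +-abelianGroup using (⁻¹-∙-comm; ⁻¹-anti-homo‿-)
  open import Algebra.Properties.CommutativeSemigroup ℕ.*-commutativeSemigroup using (xy∙z≈xz∙y)
  open import Algebra.Properties.CommutativeSemiring.Exp commutativeSemiring using (^-distrib-*)
  open import Algebra.Properties.Group +-group using (inverseˡ-unique; x∙y⁻¹≈ε⇒x≈y; x≈y⇒x∙y⁻¹≈ε)
  open import Algebra.Properties.Ring ring using (x+x≈x⇒x≈0; +-cancelˡ; -‿distribˡ-*; -‿distribʳ-*; -‿involutive)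
  open import Algebra.Properties.Semiring.Exp semiring using (^-congˡ; ^-assocʳ; ^-homo-*)
  open import Relation.Binary.Reasoning.Setoid setoid

  prime∣q⇒≡p : ∀ {r} → Prime r → r ∣ q → r ≡ p
  prime∣q⇒≡p {r} r-prime r∣q
    with prime⇒irreducible p-prime (p∣m^[1+n]⇒p∣m p k r-prime (≡.subst (r ∣_) q≡p^[1+k] r∣q))
  ... | inj₁ r≡1 = contradiction (≡.subst Prime r≡1 r-prime) ¬prime[1]
  ... | inj₂ r≡p = r≡p

  2<p : 2 ℕ.< p
  2<p = ℕ.≤∧≢⇒< (ℕ.nonTrivial⇒n>1 p {{prime⇒nonTrivial p-prime}}) (p≢2 ∘ ≡.sym)

  q≡1+[q/2]*2 : q ≡ suc (q / 2 ℕ.* 2)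
  q≡1+[q/2]*2 with q % 2 in q%2≡r | m≡m%n+[m/n]*n q 2 | m%n<n q 2
  ... | 0           | _  | _ = contradiction (prime∣q⇒≡p prime[2] (m%n≡0⇒n∣m q 2 q%2≡r)) (p≢2 ∘ ≡.sym)
  ... | 1           | eq | _ = eq
  ... | suc (suc _) | _  | ℕ.s≤s (ℕ.s≤s ())

  instance
    q-nonZero : ℕ.NonZero q
    q-nonZero = ≡.subst ℕ.NonZero (≡.sym q≡1+[q/2]*2) _

  q*q-1≡[q-1][q+1] : ℕ.pred (q ℕ.* q) ≡ ℕ.pred q ℕ.* suc q
  q*q-1≡[q-1][q+1] =
    ≡.trans (≡.cong (λ n → ℕ.pred (n ℕ.* n)) q≡1+[q/2]*2)
            (≡.trans (≡.sym (ℕ.*-suc m (suc m))) (≡.cong (λ n → ℕ.pred n ℕ.* suc n) (≡.sym q≡1+[q/2]*2)))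
    where m = q / 2 ℕ.* 2

  q*q-1≡[q/2][q+1]*2 : ℕ.pred (q ℕ.* q) ≡ q / 2 ℕ.* suc q ℕ.* 2
  q*q-1≡[q/2][q+1]*2 =
    ≡.trans q*q-1≡[q-1][q+1] (≡.trans (≡.cong (λ n → ℕ.pred n ℕ.* suc q) q≡1+[q/2]*2) (xy∙z≈xz∙y (q / 2) 2 (suc q)))

  q%3≡0⇒p≡3 : q % 3 ≡ 0 → p ≡ 3
  q%3≡0⇒p≡3 q%3≡0 = ≡.sym (prime∣q⇒≡p (from-yes (prime? 3)) (m%n≡0⇒n∣m q 3 q%3≡0))

  q%3≢0⇒3<p : q % 3 ≢ 0 → 3 ℕ.< p
  q%3≢0⇒3<p q%3≢0 = ℕ.≤∧≢⇒< 2<p λ 3≡p → q%3≢0 (n∣m⇒m%n≡0 q 3 (≡.subst (_∣ q) (≡.sym 3≡p) p∣q))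
    where
    p∣q : p ∣ q
    p∣q = ≡.subst (p ∣_) (≡.sym q≡p^[1+k]) (m∣m*n (p ℕ.^ k))

  3∣q*q-1 : q % 3 ≢ 0 → 3 ∣ ℕ.pred (q ℕ.* q)
  3∣q*q-1 q%3≢0 =
    divides (q ℕ.* q / 3) (≡.cong ℕ.pred (≡.trans (m≡m%n+[m/n]*n (q ℕ.* q) 3) (≡.cong (ℕ._+ (q ℕ.* q / 3) ℕ.* 3) q*q%3≡1)))
    where
    q*q%3≡1 : q ℕ.* q % 3 ≡ 1
    q*q%3≡1 with q % 3 | %-distribˡ-* q q 3 | m%n<n q 3
    ... | 0                 | _  | _ = contradiction ≡.refl q%3≢0
    ... | 1                 | eq | _ = eq
    ... | 2                 | eq | _ = eq
    ... | suc (suc (suc _)) | _  | ℕ.s≤s (ℕ.s≤s (ℕ.s≤s ()))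

  char-p : fromℕ p ≈ 0#
  char-p = x^n≈0⇒x≈0 (suc k ℕ.+ suc k) (begin
    fromℕ p ^ (suc k ℕ.+ suc k)       ≈⟨ fromℕ-^ p (suc k ℕ.+ suc k) ⟨
    fromℕ (p ℕ.^ (suc k ℕ.+ suc k))   ≡⟨ ≡.cong fromℕ p^[2+2k]≡q*q ⟩
    fromℕ (q ℕ.* q)                   ≈⟨ characteristic ⟩
    0#                                ∎)
    where
    p^[2+2k]≡q*q : p ℕ.^ (suc k ℕ.+ suc k) ≡ q ℕ.* q
    p^[2+2k]≡q*q = ≡.trans (ℕ.^-distribˡ-+-* p (suc k) (suc k)) (≡.sym (≡.cong₂ ℕ._*_ q≡p^[1+k] q≡p^[1+k]))

  2≉0 : fromℕ 2 ≉ 0#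
  2≉0 = fromℕ≉0 p-prime char-p 2<p

  3≉0 : q % 3 ≢ 0 → fromℕ 3 ≉ 0#
  3≉0 q%3≢0 = fromℕ≉0 p-prime char-p (q%3≢0⇒3<p q%3≢0)

  φ : Carrier → Carrier
  φ x = x ^ q

  φ-cong : Congruent _≈_ _≈_ φ
  φ-cong = ^-congˡ q

  φ-+ : ∀ x y → φ (x + y) ≈ φ x + φ y
  φ-+ x y = begin
    (x + y) ^ q                              ≡⟨ ≡.cong ((x + y) ^_) q≡p^[1+k] ⟩
    (x + y) ^ (p ℕ.^ suc k)                  ≈⟨ frobenius-^ p-prime char-p (suc k) x y ⟩
    x ^ (p ℕ.^ suc k) + y ^ (p ℕ.^ suc k)    ≡⟨ ≡.cong (λ n → x ^ n + y ^ n) q≡p^[1+k] ⟨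
    x ^ q + y ^ q                            ∎

  φ-* : ∀ x y → φ (x * y) ≈ φ x * φ y
  φ-* x y = ^-distrib-* x y q

  φ-1 : φ 1# ≈ 1#
  φ-1 = 1^n≈1 q

  φ-0 : φ 0# ≈ 0#
  φ-0 = x+x≈x⇒x≈0 (φ 0#) (trans (sym (φ-+ 0# 0#)) (φ-cong (+-identityʳ 0#)))

  φ-neg : ∀ x → φ (- x) ≈ - φ x
  φ-neg x = inverseˡ-unique (φ (- x)) (φ x) (trans (sym (φ-+ (- x) x)) (trans (φ-cong (-‿inverseˡ x)) φ-0))

  φ-sub : ∀ x y → φ (x - y) ≈ φ x - φ y
  φ-sub x y = trans (φ-+ x (- y)) (+-congˡ (φ-neg y))

  φ-involutive : ∀ x → φ (φ x) ≈ x
  φ-involutive x = trans (^-assocʳ x q q) (fermat x)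

  φ-inv : ∀ x (x≉0 : x ≉ 0#) → φ (inv x x≉0) * φ x ≈ 1#
  φ-inv x x≉0 = trans (sym (φ-* _ x)) (trans (φ-cong (*-inverseˡ x x≉0)) φ-1)

  TraceZero : Carrier → Set ℓ
  TraceZero x = φ x ≈ - x

  inFq-+ : ∀ {x y} → InFq F q x → InFq F q y → InFq F q (x + y)
  inFq-+ {x} {y} x∈Fq y∈Fq = trans (φ-+ x y) (+-cong x∈Fq y∈Fq)

  inFq-* : ∀ {x y} → InFq F q x → InFq F q y → InFq F q (x * y)
  inFq-* {x} {y} x∈Fq y∈Fq = trans (φ-* x y) (*-cong x∈Fq y∈Fq)

  inFq-fromℕ : ∀ n → InFq F q (fromℕ n)
  inFq-fromℕ zero    = φ-0
  inFq-fromℕ (suc n) = trans (φ-cong (fromℕ-suc n)) (trans (inFq-+ φ-1 (inFq-fromℕ n)) (sym (fromℕ-suc n)))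

  inFq-inv : ∀ {x} (x≉0 : x ≉ 0#) → InFq F q x → InFq F q (inv x x≉0)
  inFq-inv {x} x≉0 x∈Fq = *-inverse-unique x≉0 (trans (*-comm x _) (trans (*-congˡ (sym x∈Fq)) (φ-inv x x≉0)))

  traceZero-+ : ∀ {x y} → TraceZero x → TraceZero y → TraceZero (x + y)
  traceZero-+ {x} {y} x∈T y∈T = trans (φ-+ x y) (trans (+-cong x∈T y∈T) (⁻¹-∙-comm x y))

  traceZero-neg : ∀ {x} → TraceZero x → TraceZero (- x)
  traceZero-neg {x} x∈T = trans (φ-neg x) (-‿cong x∈T)

  traceZero-* : ∀ {x y} → TraceZero x → TraceZero y → InFq F q (x * y)
  traceZero-* {x} {y} x∈T y∈T = trans (φ-* x y) (trans (*-cong x∈T y∈T) (-x*-y≈x*y x y))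

  traceZero-*-inFq : ∀ {x a} → TraceZero x → InFq F q a → TraceZero (x * a)
  traceZero-*-inFq {x} {a} x∈T a∈Fq = trans (φ-* x a) (trans (*-cong x∈T a∈Fq) (sym (-‿distribˡ-* x a)))

  inFq-*-traceZero : ∀ {a x} → InFq F q a → TraceZero x → TraceZero (a * x)
  inFq-*-traceZero {a} {x} a∈Fq x∈T = trans (φ-* a x) (trans (*-cong a∈Fq x∈T) (sym (-‿distribʳ-* a x)))

  traceZero-inv : ∀ {x} (x≉0 : x ≉ 0#) → TraceZero x → TraceZero (inv x x≉0)
  traceZero-inv {x} x≉0 x∈T = begin
    φ (inv x x≉0)       ≈⟨ -‿involutive _ ⟨
    - - φ (inv x x≉0)   ≈⟨ -‿cong (*-inverse-unique x≉0 x*-φx⁻¹≈1) ⟩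
    - inv x x≉0         ∎
    where
    x*-φx⁻¹≈1 : x * - φ (inv x x≉0) ≈ 1#
    x*-φx⁻¹≈1 = begin
      x * - φ (inv x x≉0)     ≈⟨ -x*-y≈x*y _ _ ⟨
      - x * - - φ (inv x x≉0) ≈⟨ *-cong (sym x∈T) (-‿involutive _) ⟩
      φ x * φ (inv x x≉0)     ≈⟨ *-comm _ _ ⟩
      φ (inv x x≉0) * φ x     ≈⟨ φ-inv x x≉0 ⟩
      1#                      ∎

  inFq∧traceZero⇒≈0 : ∀ {x} → InFq F q x → TraceZero x → x ≈ 0#
  inFq∧traceZero⇒≈0 {x} x∈Fq x∈T = x*y≈0⇒y≈0 2≉0 (begin
    fromℕ 2 * x   ≈⟨ solve 1 (λ x → con (+ 2) :* x := x :+ x) refl x ⟩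
    x + x         ≈⟨ +-congʳ (trans (sym x∈Fq) x∈T) ⟩
    - x + x       ≈⟨ -‿inverseˡ x ⟩
    0#            ∎)

  U : Carrier → Carrier
  U x = φ x - x

  U-cong : Congruent _≈_ _≈_ U
  U-cong x≈y = +-cong (φ-cong x≈y) (-‿cong x≈y)

  U∈T : ∀ x → TraceZero (U x)
  U∈T x = begin
    φ (φ x - x)     ≈⟨ φ-sub (φ x) x ⟩
    φ (φ x) - φ x   ≈⟨ +-congʳ (φ-involutive x) ⟩
    x - φ x         ≈⟨ ⁻¹-anti-homo‿- (φ x) x ⟨
    - (φ x - x)     ∎

  U-shift : ∀ x {t} → InFq F q t → U (x + t) ≈ U x
  U-shift x {t} t∈Fq = trans (+-congʳ (trans (φ-+ x t) (+-congˡ t∈Fq)))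
                             (solve 3 (λ y y′ t → (y′ :+ t) :- (y :+ t) := y′ :- y) refl x (φ x) t)

  ∃-traceZero-nonzero : ∃ λ ω → TraceZero ω × ω ≉ 0#
  ∃-traceZero-nonzero =
    let a , a≉0 , aᵠ⁻¹≉1 = ∃-non-root-proper-divisor {ℕ.pred q} (ℕ.s≤s (ℕ.>-nonZero⁻¹ q)) q*q-1≡[q-1][q+1]
    in U a , U∈T a , λ Ua≈0 → aᵠ⁻¹≉1 (*-cancelˡ a≉0 (begin
      a * a ^ ℕ.pred q   ≡⟨ ≡.cong (a ^_) (ℕ.suc-pred q) ⟩
      φ a                ≈⟨ x∙y⁻¹≈ε⇒x≈y _ _ Ua≈0 ⟩
      a                  ≈⟨ *-identityʳ a ⟨
      a * 1#             ∎))

  ∃-traceZero-square≉ : fromℕ 3 ≉ 0# → ∀ c → ∃ λ Z → TraceZero Z × Z ≉ 0# × Z * Z ≉ c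
  ∃-traceZero-square≉ 3≉0 c = let ω , ω∈T , ω≉0 = ∃-traceZero-nonzero in ω-or-2ω ω∈T ω≉0 (ω * ω ≟ c)
    where
    ω-or-2ω : ∀ {ω} → TraceZero ω → ω ≉ 0# → Dec (ω * ω ≈ c) → ∃ λ Z → TraceZero Z × Z ≉ 0# × Z * Z ≉ c
    ω-or-2ω {ω} ω∈T ω≉0 (no  ω²≉c) = ω , ω∈T , ω≉0 , ω²≉c
    ω-or-2ω {ω} ω∈T ω≉0 (yes ω²≈c) = fromℕ 2 * ω , inFq-*-traceZero (inFq-fromℕ 2) ω∈T , *-nonzero 2≉0 ω≉0 , λ [2ω]²≈c →
      *-nonzero 3≉0 (*-nonzero ω≉0 ω≉0) (begin
        fromℕ 3 * (ω * ω)                       ≈⟨ solve 1 (λ w → con (+ 3) :* (w :* w) := (con (+ 2) :* w) :* (con (+ 2) :* w) :- w :* w) refl ω ⟩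
        (fromℕ 2 * ω) * (fromℕ 2 * ω) - ω * ω   ≈⟨ x≈y⇒x∙y⁻¹≈ε (trans [2ω]²≈c (sym ω²≈c)) ⟩
        0#                                      ∎)

  ∃-norm≈-1 : ∃ λ ρ → ρ * φ ρ ≈ - 1#
  ∃-norm≈-1 =
    let a , aᴱ≈-1 = ∃-nonsquare {q / 2 ℕ.* suc q} q*q-1≡[q/2][q+1]*2
    in a ^ (q / 2) , (begin
      a ^ (q / 2) * (a ^ (q / 2)) ^ q   ≈⟨ ^-assocʳ a (q / 2) (suc q) ⟩
      a ^ (q / 2 ℕ.* suc q)             ≈⟨ aᴱ≈-1 ⟩
      - 1#                              ∎)


  ∃-norm≈-m² : ∀ {m} → InFq F q m → m ≉ 0# → ∃ λ Z → Z ≉ 0# × Z * φ Z ≈ - (m * m)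
  ∃-norm≈-m² {m} m∈Fq m≉0 = m * ρ , *-nonzero m≉0 ρ≉0 , (begin
    m * ρ * φ (m * ρ)        ≈⟨ *-congˡ (trans (φ-* m ρ) (*-congʳ m∈Fq)) ⟩
    m * ρ * (m * φ ρ)        ≈⟨ solve 3 (λ m r r′ → m :* r :* (m :* r′) := m :* m :* (r :* r′)) refl m ρ (φ ρ) ⟩
    m * m * (ρ * φ ρ)        ≈⟨ *-congˡ ρφρ≈-1 ⟩
    m * m * - 1#             ≈⟨ solve 1 (λ m → m :* m :* :- con (+ 1) := :- (m :* m)) refl m ⟩
    - (m * m)                ∎)
    where
    ρ : Carrier
    ρ = proj₁ ∃-norm≈-1
    ρφρ≈-1 : ρ * φ ρ ≈ - 1#
    ρφρ≈-1 = proj₂ ∃-norm≈-1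
    ρ≉0 : ρ ≉ 0#
    ρ≉0 ρ≈0 = -1≉0 (trans (sym ρφρ≈-1) (trans (*-congʳ ρ≈0) (zeroˡ _)))

  ∃-cube-root∈Fq : q % 3 ≡ 1 → ∃ λ ζ → ζ ^ 3 ≈ 1# × ζ ≉ 1# × InFq F q ζ
  ∃-cube-root∈Fq q%3≡1 =
    let ζ , ζ³≈1 , ζ≉1 = ∃-root-of-unity (ℕ.s≤s (ℕ.s≤s ℕ.z≤n)) (3∣q*q-1 (ℕ.1+n≢0 ∘ ≡.trans (≡.sym q%3≡1)))
    in ζ , ζ³≈1 , ζ≉1 , (begin
      φ ζ            ≈⟨ ^-% q 3 ζ³≈1 ⟩
      ζ ^ (q % 3)    ≡⟨ ≡.cong (ζ ^_) q%3≡1 ⟩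
      ζ * 1#         ≈⟨ *-identityʳ ζ ⟩
      ζ              ∎)

  φ-cube-root : q % 3 ≡ 2 → ∀ {ζ} → ζ ^ 3 ≈ 1# → φ ζ ≈ ζ * ζ
  φ-cube-root q%3≡2 {ζ} ζ³≈1 = begin
    φ ζ             ≈⟨ ^-% q 3 ζ³≈1 ⟩
    ζ ^ (q % 3)     ≡⟨ ≡.cong (ζ ^_) q%3≡2 ⟩
    ζ * (ζ * 1#)    ≈⟨ *-congˡ (*-identityʳ ζ) ⟩
    ζ * ζ           ∎

  ∃-cube-root-conjugate : q % 3 ≡ 2 → ∃ λ ζ → ζ ^ 3 ≈ 1# × ζ ≉ 1# × φ ζ ≈ ζ * ζ
  ∃-cube-root-conjugate q%3≡2 =
    let ζ , ζ³≈1 , ζ≉1 = ∃-root-of-unity (ℕ.s≤s (ℕ.s≤s ℕ.z≤n)) (3∣q*q-1 (ℕ.1+n≢0 ∘ ≡.trans (≡.sym q%3≡2)))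
    in ζ , ζ³≈1 , ζ≉1 , φ-cube-root q%3≡2 ζ³≈1

  -- A / B lies in F_q, but a cube root of unity other than 1 is moved by φ.
  cube-injective : q % 3 ≡ 2 → ∀ {A B} → TraceZero A → TraceZero B → A ^ 3 ≈ B ^ 3 → A ≈ B
  cube-injective q%3≡2 {A} {B} A∈T B∈T A³≈B³ with B ≟ 0#
  ... | yes B≈0 = trans (x^n≈0⇒x≈0 3 (trans A³≈B³ (trans (^-congˡ 3 B≈0) (zeroˡ _)))) (sym B≈0)
  ... | no B≉0 = begin
    A                  ≈⟨ *-identityʳ A ⟨
    A * 1#             ≈⟨ *-congˡ (*-inverseˡ B B≉0) ⟨
    A * (B⁻¹ * B)      ≈⟨ *-assoc A B⁻¹ B ⟨
    ζ * B              ≈⟨ *-congʳ ζ≈1 ⟩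
    1# * B             ≈⟨ *-identityˡ B ⟩
    B                  ∎
    where
    B⁻¹ ζ : Carrier
    B⁻¹ = inv B B≉0
    ζ = A * B⁻¹
    ζ³≈1 : ζ ^ 3 ≈ 1#
    ζ³≈1 = begin
      (A * B⁻¹) ^ 3     ≈⟨ ^-distrib-* A B⁻¹ 3 ⟩
      A ^ 3 * B⁻¹ ^ 3   ≈⟨ *-congʳ A³≈B³ ⟩
      B ^ 3 * B⁻¹ ^ 3   ≈⟨ ^-distrib-* B B⁻¹ 3 ⟨
      (B * B⁻¹) ^ 3     ≈⟨ trans (^-congˡ 3 (*-inverseʳ B B≉0)) (1^n≈1 3) ⟩
      1#                ∎
    ζ≉0 : ζ ≉ 0#
    ζ≉0 ζ≈0 = 1≉0 (trans (sym ζ³≈1) (trans (*-congʳ ζ≈0) (zeroˡ _)))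
    ζ≈1 : ζ ≈ 1#
    ζ≈1 = sym (*-cancelˡ ζ≉0 (begin
      ζ * 1#          ≈⟨ *-identityʳ ζ ⟩
      ζ               ≈⟨ traceZero-* A∈T (traceZero-inv B≉0 B∈T) ⟨
      φ ζ             ≈⟨ φ-cube-root q%3≡2 ζ³≈1 ⟩
      ζ * ζ           ∎))

  module _ {ζ} (ζ³≈1 : ζ ^ 3 ≈ 1#) (ζ≉1 : ζ ≉ 1#) where
    open CubeRootCoordinates ζ³≈1 ζ≉1

    preimage-traceZero : InFq F q ζ → ∀ {Z Z′} → TraceZero Z → TraceZero Z′ →
                         TraceZero (Preimage.A Z Z′) × TraceZero (Preimage.B Z Z′)
    preimage-traceZero ζ∈Fq Z∈T Z′∈T =
      inFq-*-traceZero s⁻¹∈Fq (traceZero-+ (inFq-*-traceZero (inFq-* ζ∈Fq ζ∈Fq) Z∈T)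
                                           (traceZero-neg (inFq-*-traceZero ζ∈Fq Z′∈T))) ,
      inFq-*-traceZero s⁻¹∈Fq (traceZero-+ Z∈T (traceZero-neg Z′∈T))
      where
      s⁻¹∈Fq : InFq F q (inv (ζ * ζ - ζ) ζ²-ζ≉0)
      s⁻¹∈Fq = inFq-inv ζ²-ζ≉0 (trans (φ-sub _ ζ) (+-cong (inFq-* ζ∈Fq ζ∈Fq) (-‿cong ζ∈Fq)))

    module _ (φζ≈ζ² : φ ζ ≈ ζ * ζ) where

      conjugate-preimage-traceZero : ∀ Z → TraceZero (Preimage.A Z (- φ Z)) × TraceZero (Preimage.B Z (- φ Z))
      conjugate-preimage-traceZero Z = traceZero-*-inFq s⁻¹∈T ζ²Z+ζφZ∈Fq , traceZero-*-inFq s⁻¹∈T Z+φZ∈Fq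
        where
        s⁻¹∈T : TraceZero (inv (ζ * ζ - ζ) ζ²-ζ≉0)
        s⁻¹∈T = traceZero-inv ζ²-ζ≉0 (begin
          φ (ζ * ζ - ζ)                      ≈⟨ trans (φ-sub _ ζ) (+-cong (trans (φ-* ζ ζ) (*-cong φζ≈ζ² φζ≈ζ²)) (-‿cong φζ≈ζ²)) ⟩
          ζ * ζ * (ζ * ζ) - ζ * ζ            ≈⟨ solve 1 (λ z → z :* z :* (z :* z) :- z :* z := (z :^ 3 :- con (+ 1)) :* z :- (z :* z :- z)) refl ζ ⟩
          (ζ ^ 3 - 1#) * ζ - (ζ * ζ - ζ)     ≈⟨ +-congʳ (trans (*-congʳ (x≈y⇒x∙y⁻¹≈ε ζ³≈1)) (zeroˡ ζ)) ⟩
          0# - (ζ * ζ - ζ)                   ≈⟨ +-identityˡ _ ⟩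
          - (ζ * ζ - ζ)                      ∎)
        Z+φZ∈Fq : InFq F q (Z - - φ Z)
        Z+φZ∈Fq = begin
          φ (Z - - φ Z)       ≈⟨ trans (φ-sub Z _) (+-congˡ (-‿cong (trans (φ-neg (φ Z)) (-‿cong (φ-involutive Z))))) ⟩
          φ Z - - Z           ≈⟨ solve 2 (λ z y → y :- :- z := z :- :- y) refl Z (φ Z) ⟩
          Z - - φ Z           ∎
        ζ²Z+ζφZ∈Fq : InFq F q (ζ * ζ * Z - ζ * - φ Z)
        ζ²Z+ζφZ∈Fq = begin
          φ (ζ * ζ * Z - ζ * - φ Z)
            ≈⟨ trans (φ-sub _ _) (+-cong (trans (φ-* _ Z) (*-congʳ (trans (φ-* ζ ζ) (*-cong φζ≈ζ² φζ≈ζ²))))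
                                         (-‿cong (trans (φ-* ζ _) (*-cong φζ≈ζ² (trans (φ-neg (φ Z)) (-‿cong (φ-involutive Z))))))) ⟩
          ζ * ζ * (ζ * ζ) * φ Z - ζ * ζ * - Z
            ≈⟨ solve 3 (λ z x y → z :* z :* (z :* z) :* y :- z :* z :* :- x
                                  := (z :* z :* x :- z :* :- y) :+ (z :^ 3 :- con (+ 1)) :* z :* y) refl ζ Z (φ Z) ⟩
          (ζ * ζ * Z - ζ * - φ Z) + (ζ ^ 3 - 1#) * ζ * φ Z
            ≈⟨ +-congˡ (trans (*-congʳ (trans (*-congʳ (x≈y⇒x∙y⁻¹≈ε ζ³≈1)) (zeroˡ ζ))) (zeroˡ _)) ⟩
          (ζ * ζ * Z - ζ * - φ Z) + 0#
            ≈⟨ +-identityʳ _ ⟩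
          ζ * ζ * Z - ζ * - φ Z ∎

      ζ-norm : ∀ Z → ζ * Z * φ (ζ * Z) ≈ Z * φ Z
      ζ-norm Z = begin
        ζ * Z * φ (ζ * Z)       ≈⟨ *-congˡ (trans (φ-* ζ Z) (*-congʳ φζ≈ζ²)) ⟩
        ζ * Z * (ζ * ζ * φ Z)   ≈⟨ solve 3 (λ z x y → z :* x :* (z :* z :* y) := z :^ 3 :* (x :* y)) refl ζ Z (φ Z) ⟩
        ζ ^ 3 * (Z * φ Z)       ≈⟨ trans (*-congʳ ζ³≈1) (*-identityˡ _) ⟩
        Z * φ Z                 ∎

      -- Z and ζ Z have the same norm, and cannot both lie on the line Z ≈ ζ φ(Z) unless Z ≈ 0.
      norm-fibre-in-line⇒≈0 : ∀ {Z} → (∀ {Z′} → Z′ * φ Z′ ≈ Z * φ Z → Z′ ≈ ζ * φ Z′) → Z ≈ 0#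
      norm-fibre-in-line⇒≈0 {Z} in-line = x*y≈0⇒y≈0 1-ζ²≉0 (begin
        (1# - ζ * ζ) * Z       ≈⟨ solve 2 (λ z x → (con (+ 1) :- z :* z) :* x := x :- z :* (z :* x)) refl ζ Z ⟩
        Z - ζ * (ζ * Z)        ≈⟨ x≈y⇒x∙y⁻¹≈ε (trans (in-line refl) (*-congˡ (sym ζZ≈φZ))) ⟩
        0#                     ∎)
        where
        ζZ≈φZ : ζ * Z ≈ φ Z
        ζZ≈φZ = begin
          ζ * Z                 ≈⟨ in-line (ζ-norm Z) ⟩
          ζ * φ (ζ * Z)         ≈⟨ *-congˡ (trans (φ-* ζ Z) (*-congʳ φζ≈ζ²)) ⟩
          ζ * (ζ * ζ * φ Z)     ≈⟨ solve 2 (λ z y → z :* (z :* z :* y) := z :^ 3 :* y) refl ζ (φ Z) ⟩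
          ζ ^ 3 * φ Z           ≈⟨ trans (*-congʳ ζ³≈1) (*-identityˡ _) ⟩
          φ Z                   ∎
        1-ζ²≉0 : 1# - ζ * ζ ≉ 0#
        1-ζ²≉0 1-ζ²≈0 = ζ≉1 (begin
          ζ                  ≈⟨ *-identityʳ ζ ⟨
          ζ * 1#             ≈⟨ *-congˡ (x∙y⁻¹≈ε⇒x≈y _ _ 1-ζ²≈0) ⟩
          ζ * (ζ * ζ)        ≈⟨ solve 1 (λ z → z :* (z :* z) := z :^ 3) refl ζ ⟩
          ζ ^ 3              ≈⟨ ζ³≈1 ⟩
          1#                 ∎)

  module Criterion (δ γ : Carrier) (γ∈Fq : InFq F q γ) (γ≉0 : γ ≉ 0#) where

    f : Carrier → Carrier
    f = fpoly F q δ γ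

    M : Carrier
    M = Tr F q δ

    W : Carrier → Carrier
    W x = U x + U x - U δ

    cubic : Carrier → Carrier
    cubic w = w * w * w - M * M * w

    CubicInjective : Set (c ⊔ ℓ)
    CubicInjective = ∀ {A B} → TraceZero A → TraceZero B → cubic A ≈ cubic B → A ≈ B

    M∈Fq : InFq F q M
    M∈Fq = trans (φ-+ δ (φ δ)) (trans (+-congˡ (φ-involutive δ)) (+-comm _ _))

    W∈T : ∀ x → TraceZero (W x)
    W∈T x = traceZero-+ (traceZero-+ (U∈T x) (U∈T x)) (traceZero-neg (U∈T δ))

    f-cong : Congruent _≈_ _≈_ f
    f-cong x≈y = +-cong (^-congˡ (q ℕ.+ 2) (+-congʳ (U-cong x≈y))) (*-congˡ (+-cong (φ-cong x≈y) x≈y))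

    four[φf-f]≈cubic-W : ∀ x → fromℕ 4 * (φ (f x) - f x) ≈ cubic (W x)
    four[φf-f]≈cubic-W x = begin
      fromℕ 4 * (φ (f x) - f x)
        ≈⟨ *-congˡ (+-cong φ[fx]≈ (-‿cong fx≈)) ⟩
      fromℕ 4 * ((Y * (φY * φY) + γ * (x + φ x)) - (φY * (Y * Y) + γ * (φ x + x)))
        ≈⟨ *-congˡ (+-cong (+-congʳ (*-congˡ (*-cong φY≈ φY≈))) (-‿cong (+-congʳ (*-congʳ φY≈)))) ⟩
      fromℕ 4 * (((U x + δ) * ((- U x + φ δ) * (- U x + φ δ)) + γ * (x + φ x))
                 - ((- U x + φ δ) * ((U x + δ) * (U x + δ)) + γ * (φ x + x)))
        ≈⟨ solve 6 (λ u a b g y y′ →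
             con (+ 4) :* (((u :+ a) :* ((:- u :+ b) :* (:- u :+ b)) :+ g :* (y :+ y′))
                           :- ((:- u :+ b) :* ((u :+ a) :* (u :+ a)) :+ g :* (y′ :+ y)))
             := (u :+ u :- (b :- a)) :* (u :+ u :- (b :- a)) :* (u :+ u :- (b :- a))
                :- (a :+ b) :* (a :+ b) :* (u :+ u :- (b :- a)))
             refl (U x) δ (φ δ) γ x (φ x) ⟩
      cubic (W x) ∎
      where
      Y = U x + δ
      φY = φ Y
      φY≈ : φY ≈ - U x + φ δ
      φY≈ = trans (φ-+ (U x) δ) (+-congʳ (U∈T x))
      fx≈ : f x ≈ φY * (Y * Y) + γ * (φ x + x)
      fx≈ = +-congʳ (trans (^-homo-* Y q 2) (*-congˡ (*-congˡ (*-identityʳ Y))))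
      φ[fx]≈ : φ (f x) ≈ Y * (φY * φY) + γ * (x + φ x)
      φ[fx]≈ = begin
        φ (f x)                                          ≈⟨ φ-cong fx≈ ⟩
        φ (φY * (Y * Y) + γ * (φ x + x))                 ≈⟨ φ-+ _ _ ⟩
        φ (φY * (Y * Y)) + φ (γ * (φ x + x))             ≈⟨ +-cong (trans (φ-* _ _) (*-cong (φ-involutive Y) (φ-* Y Y)))
                                                                    (trans (φ-* _ _) (*-cong γ∈Fq (trans (φ-+ _ _) (+-congʳ (φ-involutive x))))) ⟩
        Y * (φY * φY) + γ * (x + φ x)                    ∎

    f-shift : ∀ x {t} → InFq F q t → f (x + t) ≈ f x + fromℕ 2 * γ * t
    f-shift x {t} t∈Fq = begin
      (U (x + t) + δ) ^ (q ℕ.+ 2) + γ * (φ (x + t) + (x + t))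
        ≈⟨ +-cong (^-congˡ (q ℕ.+ 2) (+-congʳ (U-shift x t∈Fq))) (*-congˡ (+-congʳ (trans (φ-+ x t) (+-congˡ t∈Fq)))) ⟩
      (U x + δ) ^ (q ℕ.+ 2) + γ * ((φ x + t) + (x + t))
        ≈⟨ +-congˡ (solve 4 (λ g y y′ t → g :* ((y′ :+ t) :+ (y :+ t)) := g :* (y′ :+ y) :+ con (+ 2) :* g :* t) refl γ x (φ x) t) ⟩
      (U x + δ) ^ (q ℕ.+ 2) + (γ * (φ x + x) + fromℕ 2 * γ * t)
        ≈⟨ +-assoc _ _ _ ⟨
      f x + fromℕ 2 * γ * t ∎

    cubic-injective⇒f-injective : CubicInjective → Injective _≈_ _≈_ f
    cubic-injective⇒f-injective cubic-injective {x} {y} fx≈fy = *-cancelˡ 2≉0 (begin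
      fromℕ 2 * x                    ≈⟨ solve 2 (λ x x′ → con (+ 2) :* x := (x′ :+ x) :- (x′ :- x)) refl x (φ x) ⟩
      (φ x + x) - U x                ≈⟨ +-cong φx+x≈φy+y (-‿cong Ux≈Uy) ⟩
      (φ y + y) - U y                ≈⟨ solve 2 (λ y y′ → con (+ 2) :* y := (y′ :+ y) :- (y′ :- y)) refl y (φ y) ⟨
      fromℕ 2 * y                    ∎)
      where
      Wx≈Wy : W x ≈ W y
      Wx≈Wy = cubic-injective (W∈T x) (W∈T y) (begin
        cubic (W x)                    ≈⟨ four[φf-f]≈cubic-W x ⟨
        fromℕ 4 * (φ (f x) - f x)      ≈⟨ *-congˡ (+-cong (φ-cong fx≈fy) (-‿cong fx≈fy)) ⟩
        fromℕ 4 * (φ (f y) - f y)      ≈⟨ four[φf-f]≈cubic-W y ⟩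
        cubic (W y)                    ∎)
      Ux≈Uy : U x ≈ U y
      Ux≈Uy = *-cancelˡ 2≉0 (begin
        fromℕ 2 * U x                  ≈⟨ solve 2 (λ u v → con (+ 2) :* u := (u :+ u :- v) :+ v) refl (U x) (U δ) ⟩
        W x + U δ                      ≈⟨ +-congʳ Wx≈Wy ⟩
        W y + U δ                      ≈⟨ solve 2 (λ u v → con (+ 2) :* u := (u :+ u :- v) :+ v) refl (U y) (U δ) ⟨
        fromℕ 2 * U y                  ∎)
      φx+x≈φy+y : φ x + x ≈ φ y + y
      φx+x≈φy+y = *-cancelˡ γ≉0 (+-cancelˡ _ _ _ (begin
        (U x + δ) ^ (q ℕ.+ 2) + γ * (φ x + x)   ≈⟨ fx≈fy ⟩
        (U y + δ) ^ (q ℕ.+ 2) + γ * (φ y + y)   ≈⟨ +-congʳ (^-congˡ (q ℕ.+ 2) (+-congʳ Ux≈Uy)) ⟨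
        (U x + δ) ^ (q ℕ.+ 2) + γ * (φ y + y)   ∎))

    cubic-cong : Congruent _≈_ _≈_ cubic
    cubic-cong w≈w′ = +-cong (*-cong (*-cong w≈w′ w≈w′) w≈w′) (-‿cong (*-congˡ w≈w′))

    ½ : Carrier
    ½ = inv (fromℕ 2) 2≉0

    W-section : ∀ {A} → TraceZero A → W (½ * δ - ½ * ½ * A) ≈ A
    W-section {A} A∈T = begin
      U x + U x - U δ
        ≈⟨ +-congʳ (+-cong (+-congʳ φx≈) (+-congʳ φx≈)) ⟩
      ((½ * φ δ - ½ * ½ * - A) - x) + ((½ * φ δ - ½ * ½ * - A) - x) - (φ δ - δ)
        ≈⟨ solve 4 (λ h a b A → ((h :* b :- h :* h :* :- A) :- (h :* a :- h :* h :* A))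
                                 :+ ((h :* b :- h :* h :* :- A) :- (h :* a :- h :* h :* A)) :- (b :- a)
                                 := (con (+ 2) :* h :- con (+ 1)) :* (b :- a) :+ (con (+ 2) :* h) :* (con (+ 2) :* h) :* A)
                 refl ½ δ (φ δ) A ⟩
      (fromℕ 2 * ½ - 1#) * (φ δ - δ) + (fromℕ 2 * ½) * (fromℕ 2 * ½) * A
        ≈⟨ +-cong (*-congʳ (x≈y⇒x∙y⁻¹≈ε 2*½≈1)) (*-congʳ (*-cong 2*½≈1 2*½≈1)) ⟩
      0# * (φ δ - δ) + 1# * 1# * A
        ≈⟨ solve 2 (λ u A → con (+ 0) :* u :+ con (+ 1) :* con (+ 1) :* A := A) refl (φ δ - δ) A ⟩
      A ∎
      where
      x = ½ * δ - ½ * ½ * A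
      2*½≈1 : fromℕ 2 * ½ ≈ 1#
      2*½≈1 = *-inverseʳ (fromℕ 2) 2≉0
      ½∈Fq : InFq F q ½
      ½∈Fq = inFq-inv 2≉0 (inFq-fromℕ 2)
      φx≈ : φ x ≈ ½ * φ δ - ½ * ½ * - A
      φx≈ = trans (φ-sub _ _) (+-cong (trans (φ-* ½ δ) (*-congʳ ½∈Fq))
                                     (-‿cong (trans (φ-* _ A) (*-cong (inFq-* ½∈Fq ½∈Fq) A∈T))))

    4≉0 : fromℕ 4 ≉ 0#
    4≉0 = *-nonzero 2≉0 2≉0 ∘ trans (solve 0 (con (+ 2) :* con (+ 2) := con (+ 4)) refl)

    -- f x - f y ∈ F_q, so translating y by t = (f x - f y) / 2γ ∈ F_q reaches f x without changing U.
    cubic-W-collision⇒U-equal : Injective _≈_ _≈_ f → ∀ {x y} → cubic (W x) ≈ cubic (W y) → U x ≈ U y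
    cubic-W-collision⇒U-equal f-injective {x} {y} collision = begin
      U x        ≈⟨ U-cong y+t≈x ⟨
      U (y + t)  ≈⟨ U-shift y t∈Fq ⟩
      U y        ∎
      where
      d : Carrier
      d = f x - f y
      φf-f-equal : φ (f x) - f x ≈ φ (f y) - f y
      φf-f-equal = *-cancelˡ 4≉0 (trans (four[φf-f]≈cubic-W x) (trans collision (sym (four[φf-f]≈cubic-W y))))
      d∈Fq : InFq F q d
      d∈Fq = begin
        φ (f x - f y)        ≈⟨ φ-sub (f x) (f y) ⟩
        φ (f x) - φ (f y)    ≈⟨ solve 4 (λ a a′ b b′ → a′ :- b′ := (a′ :- a) :- (b′ :- b) :+ (a :- b)) refl (f x) (φ (f x)) (f y) (φ (f y)) ⟩
        (φ (f x) - f x) - (φ (f y) - f y) + d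
                             ≈⟨ +-congʳ (x≈y⇒x∙y⁻¹≈ε φf-f-equal) ⟩
        0# + d               ≈⟨ +-identityˡ d ⟩
        d                    ∎
      2γ≉0 : fromℕ 2 * γ ≉ 0#
      2γ≉0 = *-nonzero 2≉0 γ≉0
      t : Carrier
      t = d * inv (fromℕ 2 * γ) 2γ≉0
      t∈Fq : InFq F q t
      t∈Fq = inFq-* d∈Fq (inFq-inv 2γ≉0 (inFq-* (inFq-fromℕ 2) γ∈Fq))
      y+t≈x : y + t ≈ x
      y+t≈x = f-injective (begin
        f (y + t)                                         ≈⟨ f-shift y t∈Fq ⟩
        f y + fromℕ 2 * γ * (d * inv (fromℕ 2 * γ) 2γ≉0)  ≈⟨ +-congˡ (solve 3 (λ g d i → g :* (d :* i) := d :* (g :* i)) refl (fromℕ 2 * γ) d _) ⟩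
        f y + d * (fromℕ 2 * γ * inv (fromℕ 2 * γ) 2γ≉0)  ≈⟨ +-congˡ (trans (*-congˡ (*-inverseʳ _ 2γ≉0)) (*-identityʳ d)) ⟩
        f y + (f x - f y)                                 ≈⟨ solve 2 (λ a b → b :+ (a :- b) := a) refl (f x) (f y) ⟩
        f x                                               ∎)

    f-injective⇒cubic-injective : Injective _≈_ _≈_ f → CubicInjective
    f-injective⇒cubic-injective f-injective {A} {B} A∈T B∈T cubicA≈cubicB = begin
      A        ≈⟨ W-section A∈T ⟨
      W xA     ≈⟨ +-cong (+-cong UxA≈UxB UxA≈UxB) refl ⟩
      W xB     ≈⟨ W-section B∈T ⟩
      B        ∎
      where
      xA = ½ * δ - ½ * ½ * A
      xB = ½ * δ - ½ * ½ * B
      UxA≈UxB : U xA ≈ U xB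
      UxA≈UxB = cubic-W-collision⇒U-equal f-injective
        (trans (cubic-cong (W-section A∈T)) (trans cubicA≈cubicB (cubic-cong (sym (W-section B∈T)))))

    collision⇒¬cubic-injective : ∀ {A B} → TraceZero A → TraceZero B → A ≉ B →
                                 A * A + A * B + B * B ≈ M * M → ¬ CubicInjective
    collision⇒¬cubic-injective {A} {B} A∈T B∈T A≉B A²+AB+B²≈M² cubic-injective =
      A≉B (cubic-injective A∈T B∈T (x∙y⁻¹≈ε⇒x≈y _ _ (begin
        cubic A - cubic B                          ≈⟨ solve 3 (λ a b m → (a :* a :* a :- m :* m :* a) :- (b :* b :* b :- m :* m :* b)
                                                                       := (a :- b) :* ((a :* a :+ a :* b :+ b :* b) :- m :* m)) refl A B M ⟩
        (A - B) * ((A * A + A * B + B * B) - M * M) ≈⟨ *-congˡ (x≈y⇒x∙y⁻¹≈ε A²+AB+B²≈M²) ⟩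
        (A - B) * 0#                               ≈⟨ zeroʳ _ ⟩
        0#                                         ∎)))

    cubic-injective-char-3 : fromℕ 3 ≈ 0# → CubicInjective
    cubic-injective-char-3 3≈0 {A} {B} A∈T B∈T cubicA≈cubicB = x∙y⁻¹≈ε⇒x≈y A B D≈0
      where
      D = A - B
      D∈T : TraceZero D
      D∈T = traceZero-+ A∈T (traceZero-neg B∈T)
      D[D-M][D+M]≈0 : D * ((D - M) * (D + M)) ≈ 0#
      D[D-M][D+M]≈0 = begin
        D * ((D - M) * (D + M))
          ≈⟨ solve 3 (λ a b m → (a :- b) :* (((a :- b) :- m) :* ((a :- b) :+ m))
                                := (a :* a :* a :- m :* m :* a) :- (b :* b :* b :- m :* m :* b) :- con (+ 3) :* (a :* b :* (a :- b)))
                   refl A B M ⟩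
        (cubic A - cubic B) - fromℕ 3 * (A * B * D)
          ≈⟨ +-cong (x≈y⇒x∙y⁻¹≈ε cubicA≈cubicB) (-‿cong (trans (*-congʳ 3≈0) (zeroˡ _))) ⟩
        0# - 0#
          ≈⟨ -‿inverseʳ 0# ⟩
        0# ∎
      D-M≈0⇒D≈0 : D - M ≈ 0# → D ≈ 0#
      D-M≈0⇒D≈0 D-M≈0 = inFq∧traceZero⇒≈0 (trans (φ-cong D≈M) (trans M∈Fq (sym D≈M))) D∈T
        where D≈M = x∙y⁻¹≈ε⇒x≈y D M D-M≈0
      D+M≈0⇒D≈0 : D + M ≈ 0# → D ≈ 0#
      D+M≈0⇒D≈0 D+M≈0 = inFq∧traceZero⇒≈0 (trans (φ-cong D≈-M) (trans (φ-neg M) (trans (-‿cong M∈Fq) (sym D≈-M)))) D∈T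
        where D≈-M = inverseˡ-unique D M D+M≈0
      D≈0 : D ≈ 0#
      D≈0 = decidable-stable (D ≟ 0#) λ D≉0 →
        *-nonzero D≉0 (*-nonzero (D≉0 ∘ D-M≈0⇒D≈0) (D≉0 ∘ D+M≈0⇒D≈0)) D[D-M][D+M]≈0

    cubic-injective-q%3≡2 : q % 3 ≡ 2 → M ≈ 0# → CubicInjective
    cubic-injective-q%3≡2 q%3≡2 M≈0 {A} {B} A∈T B∈T cubicA≈cubicB = cube-injective q%3≡2 A∈T B∈T (begin
      A ^ 3      ≈⟨ cube≈cubic A ⟩
      cubic A    ≈⟨ cubicA≈cubicB ⟩
      cubic B    ≈⟨ cube≈cubic B ⟨
      B ^ 3      ∎)
      where
      cube≈cubic : ∀ w → w ^ 3 ≈ cubic w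
      cube≈cubic w = begin
        w ^ 3                   ≈⟨ solve 2 (λ w m → w :^ 3 := w :* w :* w :- con (+ 0) :* m :* w) refl w M ⟩
        w * w * w - 0# * M * w  ≈⟨ +-congˡ (-‿cong (*-congʳ (*-congʳ M≈0))) ⟨
        cubic w                 ∎

    module _ {ζ} (ζ³≈1 : ζ ^ 3 ≈ 1#) (ζ≉1 : ζ ≉ 1#) where
      open CubeRootCoordinates ζ³≈1 ζ≉1

      ζ∈Fq⇒¬cubic-injective : InFq F q ζ → ∀ {Z} → TraceZero Z → (Z≉0 : Z ≉ 0#) → Z * Z ≉ - (ζ * (M * M)) →
                              ¬ CubicInjective
      ζ∈Fq⇒¬cubic-injective ζ∈Fq {Z} Z∈T Z≉0 Z²≉-ζM² =
        collision⇒¬cubic-injective (proj₁ A∈T×B∈T) (proj₂ A∈T×B∈T) A≉B (trans A²+AB+B²≈ZZ′ ZZ′≈M²)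
        where
        Z′ = M * M * inv Z Z≉0
        open Preimage Z Z′
        ZZ′≈M² : Z * Z′ ≈ M * M
        ZZ′≈M² = trans (solve 3 (λ z m i → z :* (m :* m :* i) := m :* m :* (z :* i)) refl Z M (inv Z Z≉0))
                       (trans (*-congˡ (*-inverseʳ Z Z≉0)) (*-identityʳ _))
        A∈T×B∈T : TraceZero A × TraceZero B
        A∈T×B∈T = preimage-traceZero ζ³≈1 ζ≉1 ζ∈Fq Z∈T (inFq-*-traceZero (inFq-* M∈Fq M∈Fq) (traceZero-inv Z≉0 Z∈T))
        A≉B : A ≉ B
        A≉B A≈B = Z²≉-ζM² (begin
          Z * Z                 ≈⟨ *-congˡ (A≈B⇒Z≈-ζZ′ A≈B) ⟩
          Z * - (ζ * Z′)        ≈⟨ solve 3 (λ z z′ w → z :* :- (w :* z′) := :- (w :* (z :* z′))) refl Z Z′ ζ ⟩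
          - (ζ * (Z * Z′))      ≈⟨ -‿cong (*-congˡ ZZ′≈M²) ⟩
          - (ζ * (M * M))       ∎)

      cubic-injective⇒norm-fibre-in-line : φ ζ ≈ ζ * ζ → CubicInjective → ∀ {Z} → Z * φ Z ≈ - (M * M) → Z ≈ ζ * φ Z
      cubic-injective⇒norm-fibre-in-line φζ≈ζ² cubic-injective {Z} ZφZ≈-M² =
        trans (A≈B⇒Z≈-ζZ′ A≈B) (solve 2 (λ z y → :- (z :* :- y) := z :* y) refl ζ (φ Z))
        where
        open Preimage Z (- φ Z)
        A²+AB+B²≈M² : A * A + A * B + B * B ≈ M * M
        A²+AB+B²≈M² = begin
          A * A + A * B + B * B   ≈⟨ A²+AB+B²≈ZZ′ ⟩
          Z * - φ Z               ≈⟨ -‿distribʳ-* Z (φ Z) ⟨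
          - (Z * φ Z)             ≈⟨ -‿cong ZφZ≈-M² ⟩
          - - (M * M)             ≈⟨ -‿involutive _ ⟩
          M * M                   ∎
        A∈T×B∈T : TraceZero A × TraceZero B
        A∈T×B∈T = conjugate-preimage-traceZero ζ³≈1 ζ≉1 φζ≈ζ² Z
        A≈B : A ≈ B
        A≈B = decidable-stable (A ≟ B) λ A≉B →
          collision⇒¬cubic-injective (proj₁ A∈T×B∈T) (proj₂ A∈T×B∈T) A≉B A²+AB+B²≈M² cubic-injective

    ¬cubic-injective-q%3≡1 : q % 3 ≡ 1 → ¬ CubicInjective
    ¬cubic-injective-q%3≡1 q%3≡1 =
      let ζ , ζ³≈1 , ζ≉1 , ζ∈Fq = ∃-cube-root∈Fq q%3≡1
          Z , Z∈T , Z≉0 , Z²≉-ζM² = ∃-traceZero-square≉ (3≉0 (ℕ.1+n≢0 ∘ ≡.trans (≡.sym q%3≡1))) (- (ζ * (M * M)))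
      in ζ∈Fq⇒¬cubic-injective ζ³≈1 ζ≉1 ζ∈Fq Z∈T Z≉0 Z²≉-ζM²

    ¬cubic-injective-q%3≡2 : q % 3 ≡ 2 → M ≉ 0# → ¬ CubicInjective
    ¬cubic-injective-q%3≡2 q%3≡2 M≉0 cubic-injective =
      let ζ , ζ³≈1 , ζ≉1 , φζ≈ζ² = ∃-cube-root-conjugate q%3≡2
          Z , Z≉0 , ZφZ≈-M² = ∃-norm≈-m² M∈Fq M≉0
      in Z≉0 (norm-fibre-in-line⇒≈0 ζ³≈1 ζ≉1 φζ≈ζ² λ Z′φZ′≈ZφZ →
                cubic-injective⇒norm-fibre-in-line ζ³≈1 ζ≉1 φζ≈ζ² cubic-injective (trans Z′φZ′≈ZφZ ZφZ≈-M²))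

    Condition : Set ℓ
    Condition = (q % 3 ≡ 0) ⊎ ((q % 3 ≡ 2) × M ≈ 0#)

    condition⇒cubic-injective : Condition → CubicInjective
    condition⇒cubic-injective (inj₁ q%3≡0)          = cubic-injective-char-3 (≡.subst (λ n → fromℕ n ≈ 0#) (q%3≡0⇒p≡3 q%3≡0) char-p)
    condition⇒cubic-injective (inj₂ (q%3≡2 , M≈0)) = cubic-injective-q%3≡2 q%3≡2 M≈0

    cubic-injective⇒condition : CubicInjective → Condition
    cubic-injective⇒condition cubic-injective with q % 3 in q%3≡r | m%n<n q 3
    ... | 0 | _ = inj₁ ≡.refl
    ... | 1 | _ = ⊥-elim (¬cubic-injective-q%3≡1 q%3≡r cubic-injective)
    ... | 2 | _ with M ≟ 0#
    ...   | yes M≈0 = inj₂ (≡.refl , M≈0)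
    ...   | no  M≉0 = ⊥-elim (¬cubic-injective-q%3≡2 q%3≡r M≉0 cubic-injective)
    cubic-injective⇒condition _ | suc (suc (suc _)) | ℕ.s≤s (ℕ.s≤s (ℕ.s≤s ()))

-- Opened only here: in the modules above _*_ and _×_ are the ring operations.
open import Data.Nat.Base using (_*_; _%_)
open import Data.Product.Base using (_×_)
open import Data.Sum.Base using (_⊎_)
open import Function.Bundles using (_⇔_; mk⇔)

theorem3p14 : ∀ {c ℓ} (q : ℕ) → IsOddPrimePower q →
    (F : Field c ℓ) → HasCard F (q * q) →
    (δ γ : Field.Carrier F) → InFq F q γ → ¬ (Field._≈_ F γ (Field.0# F)) →
    IsPermutation F (fpoly F q δ γ)
      ⇔ ((q % 3 ≡ 0) ⊎ ((q % 3 ≡ 2) × Field._≈_ F (Tr F q δ) (Field.0# F)))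
theorem3p14 q (p , k , p-prime , p≢2 , q≡p^[1+k]) F card δ γ γ∈Fq γ≉0 =
  mk⇔ f-permutation⇒condition condition⇒f-permutation
  where
  open FiniteField F card using (injective⇒surjective)
  open QuadraticExtension F {k = k} p-prime p≢2 q≡p^[1+k] card
  open Criterion δ γ γ∈Fq γ≉0

  f-permutation⇒condition : IsPermutation F f → Condition
  f-permutation⇒condition (f-injective , _) = cubic-injective⇒condition (f-injective⇒cubic-injective f-injective)

  condition⇒f-permutation : Condition → IsPermutation F f
  condition⇒f-permutation condition = f-injective , injective⇒surjective f-cong f-injective
    where f-injective = cubic-injective⇒f-injective (condition⇒cubic-injective condition)
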